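{- Let $p\geq 3$ be a prime and $\overline{b}\in\mathbb{Z}/p\mathbb{Z}$. The $(\overline{b},\overline{2})$-towed minimal solution of $(E_{\mathbb{Z}/p\mathbb{Z}})$ exists and is unique. Moreover, it is irreducible if and only if $\overline{b}\notin\{ -\overline{1},\overline{1},\overline{3}\}$, and in that case it equals $(\overline{ -l-1},\overline{b},\overline{2},\ldots,\overline{2},\overline{b})$ with exactly $l$ entries equal to $\overline{2}$, where $l$ is the smallest positive integer such that $\overline{l}=-\overline{(b+1)}\,(\overline{b-1})^{ -1}$.
   Context: $\overline{a}$ denotes the class of $a$ in $\mathbb{Z}/p\mathbb{Z}$. For $a_1,\ldots,a_n\in\mathbb{Z}/p\mathbb{Z}$ set $M_n(a_1,\ldots,a_n)=\begin{pmatrix} a_n & -\overline{1}\\ \overline{1} & \overline{0}\end{pmatrix}\cdots\begin{pmatrix} a_1 & -\overline{1}\\ \overline{1} & \overline{0}\end{pmatrix}$. An $n$-tuple is a solution of $(E_{\mathbb{Z}/p\mathbb{Z}})$ if $M_n(a_1,\ldots,a_n)=\pm \mathrm{Id}$. For tuples, $(a_1,\ldots,a_n)\oplus(b_1,\ldots,b_m)=(a_1+b_m,a_2,\ldots,a_{n-1},a_n+b_1,b_2,\ldots,b_{m-1})$. Write $(a_1,\ldots,a_n)\sim(b_1,\ldots,b_n)$ if $(b_1,\ldots,b_n)$ is obtained from $(a_1,\ldots,a_n)$ or from $(a_n,\ldots,a_1)$ by a cyclic permutation. A solution $(c_1,\ldots,c_n)$ with $n\geq 3$ is reducible if there exist a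 solution $(b_1,\ldots,b_l)$ and a tuple $(a_1,\ldots,a_m)$ with $l,m\geq 3$ and $(c_1,\ldots,c_n)\sim(a_1,\ldots,a_m)\oplus(b_1,\ldots,b_l)$; otherwise irreducible. A $(\overline{b},\overline{2})$-towed solution is a solution of $(E_{\mathbb{Z}/p\mathbb{Z}})$ of the form $(\overline{x},\overline{b},\overline{2},\ldots,\overline{2},\overline{y})$ with $\overline{x},\overline{y}\in\mathbb{Z}/p\mathbb{Z}$ and $l\geq 1$ consecutive entries equal to $\overline{2}$ after $\overline{b}$; it is the $(\overline{b},\overline{2})$-towed minimal solution if the number $l$ of entries $\overline{2}$ is as small as possible. -}

module Defs where

open import Data.Nat as ℕ using (ℕ; zero; suc; NonZero; _≤_)
open import Data.Nat.DivMod using (_%_; m%n<n)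
open import Data.Fin using (Fin; toℕ; fromℕ<)
open import Data.List using (List; []; _∷_; _++_; [_]; length; reverse; drop; take; replicate)
open import Data.Product using (Σ; ∃; _×_; _,_)
open import Data.Sum using (_⊎_)
open import Relation.Binary.PropositionalEquality using (_≡_)
open import Relation.Nullary using (¬_)

-- ℤ/pℤ, represented by Fin p (canonical residues 0..p-1) with arithmetic mod p.
module ZMod (p : ℕ) {{_ : NonZero p}} where

  Zp : Set
  Zp = Fin p

  cls : ℕ → Zp
  cls m = fromℕ< (m%n<n m p)

  _+ₚ_ : Zp → Zp → Zp
  a +ₚ b = cls (toℕ a ℕ.+ toℕ b)

  _*ₚ_ : Zp → Zp → Zp
  a *ₚ b = cls (toℕ a ℕ.* toℕ b)

  -ₚ_ : Zp → Zp
  -ₚ a = cls (p ℕ.∸ toℕ a)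

  _-ₚ_ : Zp → Zp → Zp
  a -ₚ b = a +ₚ (-ₚ b)

  0ₚ 1ₚ 2ₚ 3ₚ : Zp
  0ₚ = cls 0
  1ₚ = cls 1
  2ₚ = cls 2
  3ₚ = cls 3

  record Mat : Set where
    constructor mat
    field
      m11 m12 m21 m22 : Zp

  _⊗_ : Mat → Mat → Mat
  mat a b c d ⊗ mat a' b' c' d' =
    mat ((a *ₚ a') +ₚ (b *ₚ c')) ((a *ₚ b') +ₚ (b *ₚ d'))
        ((c *ₚ a') +ₚ (d *ₚ c')) ((c *ₚ b') +ₚ (d *ₚ d'))

  Id : Mat
  Id = mat 1ₚ 0ₚ 0ₚ 1ₚ

  -Id : Mat
  -Id = mat (-ₚ 1ₚ) 0ₚ 0ₚ (-ₚ 1ₚ)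

  A : Zp → Mat
  A a = mat a (-ₚ 1ₚ) 1ₚ 0ₚ

  M : List Zp → Mat
  M []       = Id
  M (a ∷ as) = M as ⊗ A a

  Solution : List Zp → Set
  Solution as = (M as ≡ Id) ⊎ (M as ≡ -Id)

  lastD : Zp → List Zp → Zp
  lastD d []       = d
  lastD _ (x ∷ xs) = lastD x xs

  initL : List Zp → List Zp
  initL []           = []
  initL (x ∷ [])     = []
  initL (x ∷ y ∷ xs) = x ∷ initL (y ∷ xs)

  -- (a₁,…,aₙ) ⊕ (b₁,…,bₘ) = (a₁+bₘ, a₂,…,aₙ₋₁, aₙ+b₁, b₂,…,bₘ₋₁)
  -- (only meaningful for n, m ≥ 2; it is only used with n, m ≥ 3)
  _⊕_ : List Zp → List Zp → List Zp
  []       ⊕ bs       = bs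
  (a ∷ as) ⊕ []       = a ∷ as
  (a ∷ as) ⊕ (b ∷ bs) =
    (a +ₚ lastD b bs) ∷ (initL as ++ ((lastD a as +ₚ b) ∷ initL bs))

  _≈rot_ : List Zp → List Zp → Set
  as ≈rot bs = ∃ λ k → bs ≡ drop k as ++ take k as

  _∼_ : List Zp → List Zp → Set
  as ∼ bs = (as ≈rot bs) ⊎ (reverse as ≈rot bs)

  Reducible : List Zp → Set
  Reducible cs = Σ (List Zp) λ as → Σ (List Zp) λ bs →
    3 ≤ length as × 3 ≤ length bs × Solution bs × (cs ∼ (as ⊕ bs))

  Irreducible : List Zp → Set
  Irreducible cs = ¬ Reducible cs

  towed : Zp → Zp → ℕ → Zp → List Zp
  towed x b l y = x ∷ b ∷ (replicate l 2ₚ ++ [ y ])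

  TowedSol : Zp → ℕ → List Zp → Set
  TowedSol b l cs = 1 ≤ l × Σ Zp λ x → Σ Zp λ y → cs ≡ towed x b l y × Solution cs

  TowedMinimal : Zp → List Zp → Set
  TowedMinimal b cs = Σ ℕ λ l → TowedSol b l cs ×
    (∀ l' (ds : List Zp) → TowedSol b l' ds → l ≤ l')

{-# OPTIONS --safe #-}
-- Write M(S) for the product of the matrices (a -1 ; 1 0) along a list S.  A list x ∷ S ++ [ y ] is a
-- solution iff the corner M(S)₁₁ is ±1, and then x and y are determined by M(S).  Hence the (b,2)-towed
-- solutions correspond to the l with M(b,2,…,2)₁₁ = (l+1)b - l = ±1; l = p - 1 always works, so the
-- minimal one exists and is unique.  If w(b - 1) = 1 and t = -(b+1)w, the condition says l ≡ -1 or l ≡ t,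
-- so for b ≠ ±1 the minimal l represents t and the solution is (-(l+1), b, 2, …, 2, b).
-- If this solution were A ⊕ B with B a solution, the middles of A and B would both be extendable
-- windows of the cyclic word, one of them avoiding the first entry: either (2,…,2) with k ≤ l twos and
-- corner k + 1, or (2,…,2,b) with j < l twos and corner (j+1)b - j.  Minimality of l rules out the
-- latter, and the former forces k = l = p - 2, i.e. t = -2, i.e. b = 3.  Conversely, for b = ±1 the
-- entry b, and for b = 3 the first entry -(t+1) = 1, split off the solution (±1, ±1, ±1).

module Submission where

open import Level using (0ℓ)
open import Algebra.Core using (Op₁; Op₂)
open import Algebra.Bundles using (CommutativeRing; RawRing)
open import Algebra.Structures using (IsCommutativeRing)
import Algebra.Properties.AbelianGroup as AbelianGroupProperties
import Algebra.Properties.Ring as RingProperties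
import Algebra.Properties.Semiring.Mult.TCOptimised as SemiringMultiplication
import Algebra.Solver.Ring.AlmostCommutativeRing as ACR
open import Data.Fin using (toℕ; #_)
open import Data.Fin.Patterns using (0F; 1F; 2F; 3F)
open import Data.Fin.Properties as Fin using (toℕ-injective; toℕ-fromℕ<; toℕ<n)
open import Data.Integer as ℤ using (ℤ; +_; -[1+_]; _⊖_)
import Data.Integer.Properties as ℤ
open import Data.List using (List; []; _∷_; _++_; [_]; replicate; length; reverse; drop; take)
open import Data.List.Properties
  using ( unfold-reverse; reverse-++; length-++; length-replicate; ++-assoc; ++-identityʳ
        ; ∷-injective; ∷-injectiveˡ; ∷-injectiveʳ; take++drop≡id )
open import Data.Maybe using (Maybe; just; nothing)
open import Data.Nat as ℕ using (ℕ; zero; suc; NonZero; ≢-nonZero; _≤_; _<_; _∸_; _%_; s≤s; z≤n)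
import Data.Nat.Properties as ℕ
open import Data.Nat.Coprimality using (coprime-Bézout; prime⇒coprime)
open import Data.Nat.DivMod using (m%n<n; %-distribˡ-+; %-distribˡ-*; m<n⇒m%n≡m; n%n≡0; m%n≤m)
open import Data.Nat.GCD using (module Bézout)
open import Data.Nat.Induction using (<-rec)
open import Data.Nat.Primality using (Prime)
open import Data.Product using (Σ; _×_; _,_; ∃; ∃₂; proj₁; proj₂)
open import Data.Sum using (_⊎_; inj₁; inj₂; [_,_]′)
open import Data.Vec as Vec using (Vec)
open import Function.Bundles using (_⇔_; mk⇔)
open import Relation.Binary.PropositionalEquality hiding ([_])
open import Relation.Nullary using (Dec; ¬_; contradiction; yes; no)
open import Relation.Nullary.Decidable using (_⊎-dec_; _×-dec_; map′)
open import Relation.Unary using (Decidable)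

open import Defs

-- Matrices over a commutative ring

record Matrix (A : Set) : Set where
  constructor matrix
  field
    e₁₁ e₁₂ e₂₁ e₂₂ : A
open Matrix public

matrix-≡ : ∀ {A : Set} {a b c d a′ b′ c′ d′ : A} →
  a ≡ a′ → b ≡ b′ → c ≡ c′ → d ≡ d′ → matrix a b c d ≡ matrix a′ b′ c′ d′
matrix-≡ refl refl refl refl = refl

-- Defined over a raw ring so that they also act on the ring solver's polynomials: a matrix identity
-- is then checked entrywise by the solver (proveᴹ below).
module MatrixOperations (A : RawRing 0ℓ 0ℓ) where
  open RawRing A

  infixl 7 _·_
  _·_ : Op₂ (Matrix Carrier)
  matrix a b c d · matrix a′ b′ c′ d′ =
    matrix (a * a′ + b * c′) (a * b′ + b * d′) (c * a′ + d * c′) (c * b′ + d * d′)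

  scalar : Carrier → Matrix Carrier
  scalar e = matrix e 0# 0# e

  I : Matrix Carrier
  I = scalar 1#

  det : Matrix Carrier → Carrier
  det (matrix a b c d) = a * d + - (b * c)

  adj : Op₁ (Matrix Carrier)
  adj (matrix a b c d) = matrix d (- b) (- c) a

  step : Carrier → Matrix Carrier
  step a = matrix a (- 1#) 1# 0#

  twos : Carrier → Matrix Carrier
  twos L = matrix (L + 1#) (- L) L (1# + - L)

module OverCommutativeRing
  {R : Set} {_⊕_ _⊛_ : Op₂ R} {⊝_ : Op₁ R} {𝟘 𝟙 : R}
  (isCommutativeRing : IsCommutativeRing _≡_ _⊕_ _⊛_ ⊝_ 𝟘 𝟙) where

  commutativeRing : CommutativeRing 0ℓ 0ℓ
  commutativeRing = record { isCommutativeRing = isCommutativeRing }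

  open CommutativeRing commutativeRing
    using ( _+_; _*_; -_; 0#; 1#; rawRing; ring; semiring; +-abelianGroup; +-comm; +-identityˡ
          ; *-comm; *-assoc; *-identityˡ; *-identityʳ; -‿inverseˡ; -‿inverseʳ )
  open RingProperties ring using (-0#≈0#; -‿involutive; -‿distribˡ-*; -‿distribʳ-*; -1*x≈-x)
  open AbelianGroupProperties +-abelianGroup
    using ( xyx⁻¹≈y; ⁻¹-anti-homo‿-; ⁻¹-∙-comm; inverseˡ-unique; x∙y⁻¹≈ε⇒x≈y; x≈y⇒x∙y⁻¹≈ε
          ; ⁻¹-injective )
  -- With the type-checking-optimised multiplication, fromℕ 1 and fromℕ 2 reduce to 1# and 1# + 1#,
  -- so the solver's constants agree definitionally with 1#, 2# and 3#.
  open SemiringMultiplication semiring using (×-homo-+; ×1-homo-*) renaming (_×_ to _×ᴿ_)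
  open ≡-Reasoning

  infixl 6 _-_
  _-_ : Op₂ R
  x - y = x + - y

  2# 3# : R
  2# = 1# + 1#
  3# = 2# + 1#

  fromℕ : ℕ → R
  fromℕ n = n ×ᴿ 1#

  fromℕ-+ : ∀ m n → fromℕ (m ℕ.+ n) ≡ fromℕ m + fromℕ n
  fromℕ-+ = ×-homo-+ 1#

  fromℕ-suc : ∀ n → fromℕ (suc n) ≡ fromℕ n + 1#
  fromℕ-suc n = trans (cong fromℕ (ℕ.+-comm 1 n)) (fromℕ-+ n 1)

  fromℕ-∸ : ∀ {m n} → n ℕ.≤ m → fromℕ (m ℕ.∸ n) ≡ fromℕ m - fromℕ n
  fromℕ-∸ {m} {n} n≤m = begin
    fromℕ (m ℕ.∸ n)                      ≡⟨ xyx⁻¹≈y (fromℕ n) (fromℕ (m ℕ.∸ n)) ⟨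
    fromℕ n + fromℕ (m ℕ.∸ n) - fromℕ n  ≡⟨ cong (_- fromℕ n) (fromℕ-+ n (m ℕ.∸ n)) ⟨
    fromℕ (n ℕ.+ (m ℕ.∸ n)) - fromℕ n    ≡⟨ cong (λ k → fromℕ k - fromℕ n) (ℕ.m+[n∸m]≡n n≤m) ⟩
    fromℕ m - fromℕ n                    ∎

  fromℤ : ℤ → R
  fromℤ (+ n)    = fromℕ n
  fromℤ -[1+ n ] = - fromℕ (suc n)

  fromℤ-neg : ∀ i → fromℤ (ℤ.- i) ≡ - fromℤ i
  fromℤ-neg (+ zero)  = sym -0#≈0#
  fromℤ-neg (+ suc n) = refl
  fromℤ-neg -[1+ n ]  = sym (-‿involutive (fromℕ (suc n)))

  fromℤ-⊖ : ∀ m n → fromℤ (m ⊖ n) ≡ fromℕ m - fromℕ n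
  fromℤ-⊖ m n with ℕ.<-≤-connex m n
  ... | inj₁ m<n = begin
    fromℤ (m ⊖ n)               ≡⟨ cong fromℤ (ℤ.⊖-< m<n) ⟩
    fromℤ (ℤ.- (+ (n ℕ.∸ m)))   ≡⟨ fromℤ-neg (+ (n ℕ.∸ m)) ⟩
    - fromℕ (n ℕ.∸ m)           ≡⟨ cong -_ (fromℕ-∸ (ℕ.<⇒≤ m<n)) ⟩
    - (fromℕ n - fromℕ m)       ≡⟨ ⁻¹-anti-homo‿- (fromℕ n) (fromℕ m) ⟩
    fromℕ m - fromℕ n           ∎
  ... | inj₂ n≤m = trans (cong fromℤ (ℤ.⊖-≥ n≤m)) (fromℕ-∸ n≤m)

  fromℤ-+ : ∀ i j → fromℤ (i ℤ.+ j) ≡ fromℤ i + fromℤ j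
  fromℤ-+ (+ m)    (+ n)    = fromℕ-+ m n
  fromℤ-+ (+ m)    -[1+ n ] = fromℤ-⊖ m (suc n)
  fromℤ-+ -[1+ m ] (+ n)    = trans (fromℤ-⊖ n (suc m)) (+-comm (fromℕ n) (- fromℕ (suc m)))
  fromℤ-+ -[1+ m ] -[1+ n ] = begin
    - fromℕ (suc (suc (m ℕ.+ n)))        ≡⟨ cong (λ k → - fromℕ (suc k)) (ℕ.+-suc m n) ⟨
    - fromℕ (suc m ℕ.+ suc n)            ≡⟨ cong -_ (fromℕ-+ (suc m) (suc n)) ⟩
    - (fromℕ (suc m) + fromℕ (suc n))    ≡⟨ ⁻¹-∙-comm (fromℕ (suc m)) (fromℕ (suc n)) ⟨
    - fromℕ (suc m) + - fromℕ (suc n)    ∎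

  fromℤ-pos-* : ∀ m j → fromℤ (+ m ℤ.* j) ≡ fromℕ m * fromℤ j
  fromℤ-pos-* m (+ n)    = trans (cong fromℤ (sym (ℤ.pos-* m n))) (×1-homo-* m n)
  fromℤ-pos-* m -[1+ n ] = begin
    fromℤ (+ m ℤ.* ℤ.- (+ suc n))    ≡⟨ cong fromℤ (ℤ.neg-distribʳ-* (+ m) (+ suc n)) ⟨
    fromℤ (ℤ.- (+ m ℤ.* + suc n))    ≡⟨ fromℤ-neg (+ m ℤ.* + suc n) ⟩
    - fromℤ (+ m ℤ.* + suc n)        ≡⟨ cong -_ (fromℤ-pos-* m (+ suc n)) ⟩
    - (fromℕ m * fromℕ (suc n))      ≡⟨ -‿distribʳ-* (fromℕ m) (fromℕ (suc n)) ⟩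
    fromℕ m * - fromℕ (suc n)        ∎

  fromℤ-* : ∀ i j → fromℤ (i ℤ.* j) ≡ fromℤ i * fromℤ j
  fromℤ-* (+ m)    j = fromℤ-pos-* m j
  fromℤ-* -[1+ m ] j = begin
    fromℤ (ℤ.- (+ suc m) ℤ.* j)    ≡⟨ cong fromℤ (ℤ.neg-distribˡ-* (+ suc m) j) ⟨
    fromℤ (ℤ.- (+ suc m ℤ.* j))    ≡⟨ fromℤ-neg (+ suc m ℤ.* j) ⟩
    - fromℤ (+ suc m ℤ.* j)        ≡⟨ cong -_ (fromℤ-pos-* (suc m) j) ⟩
    - (fromℕ (suc m) * fromℤ j)    ≡⟨ -‿distribˡ-* (fromℕ (suc m)) (fromℤ j) ⟩
    - fromℕ (suc m) * fromℤ j      ∎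

  fromℤ-homomorphism : ACR._-Raw-AlmostCommutative⟶_ ℤ.+-*-rawRing (ACR.fromCommutativeRing commutativeRing)
  fromℤ-homomorphism = record
    { ⟦_⟧ = fromℤ ; +-homo = fromℤ-+ ; *-homo = fromℤ-* ; -‿homo = fromℤ-neg
    ; 0-homo = refl ; 1-homo = refl }

  fromℤ-≟ : ∀ i j → Maybe (fromℤ i ≡ fromℤ j)
  fromℤ-≟ i j with i ℤ.≟ j
  ... | yes i≡j = just (cong fromℤ i≡j)
  ... | no _    = nothing

  open import Algebra.Solver.Ring ℤ.+-*-rawRing (ACR.fromCommutativeRing commutativeRing)
    fromℤ-homomorphism fromℤ-≟
    using (solve; prove; _:=_; _:+_; _:*_; :-_; _:-_; con; var; Polynomial; ⟦_⟧; ⟦_⟧↓)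

  polynomials : ℕ → RawRing 0ℓ 0ℓ
  polynomials n = record
    { Carrier = Polynomial n ; _≈_ = _≡_ ; _+_ = _:+_ ; _*_ = _:*_ ; -_ = :-_
    ; 0# = con (+ 0) ; 1# = con (+ 1) }

  open MatrixOperations rawRing public
  module Poly {n : ℕ} = MatrixOperations (polynomials n)

  entries : Matrix R → Vec R 4
  entries (matrix a b c d) = a Vec.∷ b Vec.∷ c Vec.∷ d Vec.∷ Vec.[]

  ⟦_⟧ᴹ : ∀ {n} → Matrix (Polynomial n) → Vec R n → Matrix R
  ⟦ matrix a b c d ⟧ᴹ ρ = matrix (⟦ a ⟧ ρ) (⟦ b ⟧ ρ) (⟦ c ⟧ ρ) (⟦ d ⟧ ρ)

  proveᴹ : ∀ {n} (ρ : Vec R n) (X Y : Matrix (Polynomial n)) →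
    ⟦ e₁₁ X ⟧↓ ρ ≡ ⟦ e₁₁ Y ⟧↓ ρ → ⟦ e₁₂ X ⟧↓ ρ ≡ ⟦ e₁₂ Y ⟧↓ ρ →
    ⟦ e₂₁ X ⟧↓ ρ ≡ ⟦ e₂₁ Y ⟧↓ ρ → ⟦ e₂₂ X ⟧↓ ρ ≡ ⟦ e₂₂ Y ⟧↓ ρ →
    ⟦ X ⟧ᴹ ρ ≡ ⟦ Y ⟧ᴹ ρ
  proveᴹ ρ (matrix a b c d) (matrix a′ b′ c′ d′) h₁₁ h₁₂ h₂₁ h₂₂ =
    matrix-≡ (prove ρ a a′ h₁₁) (prove ρ b b′ h₁₂) (prove ρ c c′ h₂₁) (prove ρ d d′ h₂₂)

  𝕏 : ∀ {n} → Matrix (Polynomial (4 ℕ.+ n))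
  𝕏 = matrix (var 0F) (var 1F) (var 2F) (var 3F)

  ·-assoc : ∀ X Y Z → (X · Y) · Z ≡ X · (Y · Z)
  ·-assoc X Y Z = proveᴹ (entries X Vec.++ entries Y Vec.++ entries Z)
    ((𝕏 Poly.· 𝕐) Poly.· ℤ̃) (𝕏 Poly.· (𝕐 Poly.· ℤ̃)) refl refl refl refl
    where
    𝕐 ℤ̃ : Matrix (Polynomial 12)
    𝕐 = matrix (var (# 4)) (var (# 5)) (var (# 6)) (var (# 7))
    ℤ̃ = matrix (var (# 8)) (var (# 9)) (var (# 10)) (var (# 11))

  ·-identityˡ : ∀ X → I · X ≡ X
  ·-identityˡ X = proveᴹ (entries X) (Poly.I Poly.· 𝕏) 𝕏 refl refl refl refl

  ·-identityʳ : ∀ X → X · I ≡ X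
  ·-identityʳ X = proveᴹ (entries X) (𝕏 Poly.· Poly.I) 𝕏 refl refl refl refl

  adj-· : ∀ X → adj X · X ≡ scalar (det X)
  adj-· X = proveᴹ (entries X) (Poly.adj 𝕏 Poly.· 𝕏) (Poly.scalar (Poly.det 𝕏)) refl refl refl refl

  adj-scalar-· : ∀ X ε → (adj X · scalar ε) · X ≡ scalar (ε * det X)
  adj-scalar-· X ε = proveᴹ (entries X Vec.∷ʳ ε)
    ((Poly.adj 𝕏 Poly.· Poly.scalar (var (# 4))) Poly.· 𝕏) (Poly.scalar (var (# 4) :* Poly.det 𝕏))
    refl refl refl refl

  e₁₂-adj-·-scalar : ∀ X ε → e₁₂ (adj X · scalar ε) ≡ - (e₁₂ X * ε)
  e₁₂-adj-·-scalar X ε = prove (entries X Vec.∷ʳ ε)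
    (e₁₂ (Poly.adj 𝕏 Poly.· Poly.scalar (var (# 4)))) (:- (var 1F :* var (# 4))) refl

  det-·-step : ∀ X a → det (X · step a) ≡ det X
  det-·-step X a =
    prove (entries X Vec.∷ʳ a) (Poly.det (𝕏 Poly.· Poly.step (var (# 4)))) (Poly.det 𝕏) refl

  e₁₂-·-step : ∀ X a → e₁₂ (X · step a) ≡ - e₁₁ X
  e₁₂-·-step X a =
    prove (entries X Vec.∷ʳ a) (e₁₂ (𝕏 Poly.· Poly.step (var (# 4)))) (:- var 0F) refl

  ·-scalar⇒≡adj : ∀ {X Y ε} → det X ≡ 1# → X · Y ≡ scalar ε → Y ≡ adj X · scalar ε
  ·-scalar⇒≡adj {X} {Y} {ε} det≡1 XY≡ε = begin
    Y                      ≡⟨ ·-identityˡ Y ⟨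
    I · Y                  ≡⟨ cong (λ d → scalar d · Y) det≡1 ⟨
    scalar (det X) · Y     ≡⟨ cong (_· Y) (adj-· X) ⟨
    (adj X · X) · Y        ≡⟨ ·-assoc (adj X) X Y ⟩
    adj X · (X · Y)        ≡⟨ cong (adj X ·_) XY≡ε ⟩
    adj X · scalar ε       ∎

  ·-scalar-comm : ∀ {X Y ε} → det X ≡ 1# → X · Y ≡ scalar ε → Y · X ≡ scalar ε
  ·-scalar-comm {X} {Y} {ε} det≡1 XY≡ε = begin
    Y · X                     ≡⟨ cong (_· X) (·-scalar⇒≡adj det≡1 XY≡ε) ⟩
    (adj X · scalar ε) · X    ≡⟨ adj-scalar-· X ε ⟩
    scalar (ε * det X)        ≡⟨ cong (λ d → scalar (ε * d)) det≡1 ⟩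
    scalar (ε * 1#)           ≡⟨ cong scalar (*-identityʳ ε) ⟩
    scalar ε                  ∎

  steps : List R → Matrix R
  steps []       = I
  steps (a ∷ as) = steps as · step a

  steps-++ : ∀ xs ys → steps (xs ++ ys) ≡ steps ys · steps xs
  steps-++ []       ys = sym (·-identityʳ (steps ys))
  steps-++ (x ∷ xs) ys = begin
    steps (xs ++ ys) · step x          ≡⟨ cong (_· step x) (steps-++ xs ys) ⟩
    (steps ys · steps xs) · step x     ≡⟨ ·-assoc (steps ys) (steps xs) (step x) ⟩
    steps ys · (steps xs · step x)     ∎

  det-steps : ∀ xs → det (steps xs) ≡ 1#
  det-steps []       = prove Vec.[] (Poly.det Poly.I) (con (+ 1)) refl
  det-steps (x ∷ xs) = trans (det-·-step (steps xs) x) (det-steps xs)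

  e₁₁-steps-[_] : ∀ a → e₁₁ (steps [ a ]) ≡ a
  e₁₁-steps-[ a ] = prove (a Vec.∷ Vec.[]) (e₁₁ (Poly.I Poly.· Poly.step (var 0F))) (var 0F) refl

  IsSign : R → Set
  IsSign e = e ≡ 1# ⊎ e ≡ - 1#

  sign-square : ∀ {e} → IsSign e → e * e ≡ 1#
  sign-square (inj₁ refl) = solve 0 (con (+ 1) :* con (+ 1) := con (+ 1)) refl
  sign-square (inj₂ refl) = solve 0 (:- con (+ 1) :* :- con (+ 1) := con (+ 1)) refl

  sign-neg : ∀ {e} → IsSign e → IsSign (- e)
  sign-neg (inj₁ refl) = inj₂ refl
  sign-neg (inj₂ refl) = inj₁ (-‿involutive 1#)

  sign-* : ∀ {e f} → IsSign e → IsSign f → IsSign (e * f)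
  sign-* {f = f} (inj₁ refl) sf = subst IsSign (sym (*-identityˡ f)) sf
  sign-* {f = f} (inj₂ refl) sf = subst IsSign (sym (-1*x≈-x f)) (sign-neg sf)

  sign-cancelˡ : ∀ {q} z → q * q ≡ 1# → q * (q * z) ≡ z
  sign-cancelˡ {q} z q²≡1 = begin
    q * (q * z)    ≡⟨ *-assoc q q z ⟨
    q * q * z      ≡⟨ cong (_* z) q²≡1 ⟩
    1# * z         ≡⟨ *-identityˡ z ⟩
    z              ∎

  sign-solve : ∀ {q x c} → q * q ≡ 1# → q * x ≡ c → x ≡ q * c
  sign-solve {q} {x} q²≡1 qx≡c = trans (sym (sign-cancelˡ x q²≡1)) (cong (q *_) qx≡c)

  +1-sign : ∀ {K} → IsSign (K + 1#) → K ≡ 0# ⊎ K ≡ - 2#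
  +1-sign {K} (inj₁ K+1≡1) = inj₁ (begin
    K                ≡⟨ solve 1 (λ K → K := K :+ con (+ 1) :- con (+ 1)) refl K ⟩
    K + 1# - 1#      ≡⟨ cong (_- 1#) K+1≡1 ⟩
    1# - 1#          ≡⟨ -‿inverseʳ 1# ⟩
    0#               ∎)
  +1-sign {K} (inj₂ K+1≡-1) = inj₂ (begin
    K                ≡⟨ solve 1 (λ K → K := K :+ con (+ 1) :- con (+ 1)) refl K ⟩
    K + 1# - 1#      ≡⟨ cong (_- 1#) K+1≡-1 ⟩
    - 1# - 1#        ≡⟨ solve 0 (:- con (+ 1) :- con (+ 1) := :- con (+ 2)) refl ⟩
    - 2#             ∎)

  diagonal-det⇒scalar : ∀ {a d} → IsSign d → det (matrix a 0# 0# d) ≡ 1# →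
    matrix a 0# 0# d ≡ scalar d
  diagonal-det⇒scalar {a} {d} sign det≡1 = cong (λ z → matrix z 0# 0# d) (begin
    a             ≡⟨ sign-solve (sign-square sign) (trans (*-comm d a) ad≡1) ⟩
    d * 1#        ≡⟨ *-identityʳ d ⟩
    d             ∎)
    where
    ad≡1 : a * d ≡ 1#
    ad≡1 = trans (solve 2 (λ a d → a :* d := a :* d :- con (+ 0) :* con (+ 0)) refl a d) det≡1

  data IsSolution (as : List R) : Set where
    solution : ∀ {ε} → IsSign ε → steps as ≡ scalar ε → IsSolution as

  solution-rotate : ∀ xs ys → IsSolution (xs ++ ys) → IsSolution (ys ++ xs)
  solution-rotate xs ys (solution {ε} sign xs++ys≡ε) = solution sign (begin
    steps (ys ++ xs)          ≡⟨ steps-++ ys xs ⟩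
    steps xs · steps ys       ≡⟨ ·-scalar-comm (det-steps ys) (trans (sym (steps-++ xs ys)) xs++ys≡ε) ⟩
    scalar ε                  ∎)

  record Extendable (S : List R) : Set where
    constructor extendable
    field
      isSign : IsSign (e₁₁ (steps S))

  closeˡ closeʳ : List R → R
  closeˡ S = e₁₁ (steps S) * - e₁₂ (steps S)
  closeʳ S = e₁₁ (steps S) * e₂₁ (steps S)

  steps-enclosed : ∀ x S y → steps (x ∷ S ++ [ y ]) ≡ (step y · steps S) · step x
  steps-enclosed x S y =
    cong (_· step x) (trans (steps-++ S [ y ]) (cong (_· steps S) (·-identityˡ (step y))))

  enclosed-entries : ∀ x Q y → (step y · Q) · step x ≡
    matrix ((y * e₁₁ Q - e₂₁ Q) * x + (y * e₁₂ Q - e₂₂ Q)) (e₂₁ Q - y * e₁₁ Q)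
           (e₁₁ Q * x + e₁₂ Q)                             (- e₁₁ Q)
  enclosed-entries x Q y = proveᴹ (entries Q Vec.++ x Vec.∷ y Vec.∷ Vec.[])
    ((Poly.step y′ Poly.· 𝕏) Poly.· Poly.step x′)
    (matrix ((y′ :* var 0F :- var 2F) :* x′ :+ (y′ :* var 1F :- var 3F)) (var 2F :- y′ :* var 0F)
            (var 0F :* x′ :+ var 1F) (:- var 0F))
    refl refl refl refl
    where
    x′ y′ : Polynomial 6
    x′ = var (# 4)
    y′ = var (# 5)

  solution⇒extendable : ∀ {x S y} → IsSolution (x ∷ S ++ [ y ]) →
    Extendable S × x ≡ closeˡ S × y ≡ closeʳ S
  solution⇒extendable {x} {S} {y} (solution {ε} sign T≡ε) = extendable sign₁₁ , x≡ , y≡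
    where
    Q = steps S
    eq : matrix _ _ _ _ ≡ scalar ε
    eq = trans (sym (enclosed-entries x Q y)) (trans (sym (steps-enclosed x S y)) T≡ε)
    sign₁₁ : IsSign (e₁₁ Q)
    sign₁₁ = subst IsSign (-‿involutive (e₁₁ Q)) (sign-neg (subst IsSign (sym (cong e₂₂ eq)) sign))
    x≡ : x ≡ closeˡ S
    x≡ = sign-solve (sign-square sign₁₁) (inverseˡ-unique _ _ (cong e₂₁ eq))
    y≡ : y ≡ closeʳ S
    y≡ = sign-solve (sign-square sign₁₁)
           (trans (*-comm (e₁₁ Q) y) (sym (x∙y⁻¹≈ε⇒x≈y _ _ (cong e₁₂ eq))))

  extendable⇒solution : ∀ {S} → Extendable S → IsSolution (closeˡ S ∷ S ++ [ closeʳ S ])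
  extendable⇒solution {S} (extendable sign₁₁) = solution (sign-neg sign₁₁)
    (trans diagonal (diagonal-det⇒scalar (sign-neg sign₁₁)
      (trans (cong det (sym diagonal)) (det-steps (closeˡ S ∷ S ++ [ closeʳ S ])))))
    where
    Q  = steps S
    q₁ = e₁₁ Q
    q₁²≡1 : q₁ * q₁ ≡ 1#
    q₁²≡1 = sign-square sign₁₁
    corner₁₂ : e₂₁ Q - closeʳ S * q₁ ≡ 0#
    corner₁₂ = begin
      e₂₁ Q - q₁ * e₂₁ Q * q₁    ≡⟨ cong (λ z → e₂₁ Q - z) (*-comm (q₁ * e₂₁ Q) q₁) ⟩
      e₂₁ Q - q₁ * (q₁ * e₂₁ Q)  ≡⟨ cong (λ z → e₂₁ Q - z) (sign-cancelˡ (e₂₁ Q) q₁²≡1) ⟩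
      e₂₁ Q - e₂₁ Q              ≡⟨ -‿inverseʳ (e₂₁ Q) ⟩
      0#                         ∎
    corner₂₁ : q₁ * closeˡ S + e₁₂ Q ≡ 0#
    corner₂₁ = trans (cong (_+ e₁₂ Q) (sign-cancelˡ (- e₁₂ Q) q₁²≡1)) (-‿inverseˡ (e₁₂ Q))
    corner₁₁ : R
    corner₁₁ = (closeʳ S * q₁ - e₂₁ Q) * closeˡ S + (closeʳ S * e₁₂ Q - e₂₂ Q)
    diagonal : steps (closeˡ S ∷ S ++ [ closeʳ S ]) ≡ matrix corner₁₁ 0# 0# (- q₁)
    diagonal = trans (steps-enclosed (closeˡ S) S (closeʳ S)) (trans (enclosed-entries (closeˡ S) Q (closeʳ S))
      (cong₂ (λ b c → matrix corner₁₁ b c (- q₁)) corner₁₂ corner₂₁))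

  -- M(S) · step u is ε times the adjugate of M(v ∷ S′); comparing (1,2) entries gives
  -- M(S)₁₁ = - ε M(S′)₁₁.
  extendable-complement : ∀ u S v S′ → IsSolution (u ∷ S ++ v ∷ S′) → Extendable S′ → Extendable S
  extendable-complement u S v S′ (solution {ε} sign T≡ε) (extendable sign′) =
    extendable (subst IsSign corner≡ (sign-* (sign-neg sign′) sign))
    where
    X = steps (v ∷ S′)
    split : X · (steps S · step u) ≡ scalar ε
    split = begin
      X · (steps S · step u)      ≡⟨ ·-assoc X (steps S) (step u) ⟨
      (X · steps S) · step u      ≡⟨ cong (_· step u) (steps-++ S (v ∷ S′)) ⟨
      steps (u ∷ S ++ v ∷ S′)     ≡⟨ T≡ε ⟩
      scalar ε                    ∎
    corner≡ : - e₁₁ (steps S′) * ε ≡ e₁₁ (steps S)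
    corner≡ = ⁻¹-injective (begin
      - (- e₁₁ (steps S′) * ε)    ≡⟨ cong (λ z → - (z * ε)) (e₁₂-·-step (steps S′) v) ⟨
      - (e₁₂ X * ε)               ≡⟨ e₁₂-adj-·-scalar X ε ⟨
      e₁₂ (adj X · scalar ε)      ≡⟨ cong e₁₂ (·-scalar⇒≡adj (det-steps (v ∷ S′)) split) ⟨
      e₁₂ (steps S · step u)      ≡⟨ e₁₂-·-step (steps S) u ⟩
      - e₁₁ (steps S)             ∎)

  steps-twos : ∀ l → steps (replicate l 2#) ≡ twos (fromℕ l)
  steps-twos zero    = proveᴹ Vec.[] Poly.I (Poly.twos (con (+ 0))) refl refl refl refl
  steps-twos (suc l) = begin
    steps (replicate l 2#) · step 2#     ≡⟨ cong (_· step 2#) (steps-twos l) ⟩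
    twos (fromℕ l) · step 2#             ≡⟨ proveᴹ (fromℕ l Vec.∷ Vec.[])
                                              (Poly.twos (var 0F) Poly.· Poly.step (con (+ 2)))
                                              (Poly.twos (var 0F :+ con (+ 1))) refl refl refl refl ⟩
    twos (fromℕ l + 1#)                  ≡⟨ cong twos (fromℕ-suc l) ⟨
    twos (fromℕ (suc l))                 ∎

  e₁₁-steps-twos : ∀ l → e₁₁ (steps (replicate l 2#)) ≡ fromℕ l + 1#
  e₁₁-steps-twos l = cong e₁₁ (steps-twos l)

  corner : R → R → R
  corner b L = (L + 1#) * b - L

  corner-at-zero : ∀ b → corner b 0# ≡ b
  corner-at-zero = solve 1 (λ b → (con (+ 0) :+ con (+ 1)) :* b :- con (+ 0) := b) refl

  corner-at-minus-one : ∀ b → corner b (- 1#) ≡ 1#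
  corner-at-minus-one = solve 1 (λ b → (:- con (+ 1) :+ con (+ 1)) :* b :- :- con (+ 1) := con (+ 1)) refl

  steps-∷-twos : ∀ b l → let L = fromℕ l in
    steps (b ∷ replicate l 2#) ≡ matrix (corner b L) (- (L + 1#)) (corner b L - b + 1#) (- L)
  steps-∷-twos b l = trans (cong (_· step b) (steps-twos l))
    (proveᴹ (fromℕ l Vec.∷ b Vec.∷ Vec.[]) (Poly.twos L Poly.· Poly.step b′)
      (matrix ((L :+ con (+ 1)) :* b′ :- L) (:- (L :+ con (+ 1)))
              ((L :+ con (+ 1)) :* b′ :- L :- b′ :+ con (+ 1)) (:- L))
      refl refl refl refl)
    where
    L b′ : Polynomial 2
    L  = var 0F
    b′ = var 1F

  e₁₁-steps-twos-∷ʳ : ∀ b l → e₁₁ (steps (replicate l 2# ++ [ b ])) ≡ corner b (fromℕ l)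
  e₁₁-steps-twos-∷ʳ b l = begin
    e₁₁ (steps (replicate l 2# ++ [ b ]))       ≡⟨ cong e₁₁ (steps-++ (replicate l 2#) [ b ]) ⟩
    e₁₁ (steps [ b ] · steps (replicate l 2#))  ≡⟨ cong (λ X → e₁₁ (steps [ b ] · X)) (steps-twos l) ⟩
    e₁₁ ((I · step b) · twos (fromℕ l))         ≡⟨ prove (fromℕ l Vec.∷ b Vec.∷ Vec.[])
                                                     (e₁₁ ((Poly.I Poly.· Poly.step b′) Poly.· Poly.twos L))
                                                     ((L :+ con (+ 1)) :* b′ :- L) refl ⟩
    corner b (fromℕ l)                          ∎
    where
    L b′ : Polynomial 2
    L  = var 0F
    b′ = var 1F

  module _ {b} l (corner≡-1 : corner b (fromℕ l) ≡ - 1#) where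

    closeˡ-∷-twos : closeˡ (b ∷ replicate l 2#) ≡ - (fromℕ l + 1#)
    closeˡ-∷-twos = begin
      e₁₁ (steps (b ∷ replicate l 2#)) * - e₁₂ (steps (b ∷ replicate l 2#))
                                         ≡⟨ cong (λ X → e₁₁ X * - e₁₂ X) (steps-∷-twos b l) ⟩
      corner b L * - - (L + 1#)          ≡⟨ cong (λ c → c * - - (L + 1#)) corner≡-1 ⟩
      - 1# * - - (L + 1#)                ≡⟨ solve 1 (λ L → :- con (+ 1) :* :- (:- (L :+ con (+ 1)))
                                                          := :- (L :+ con (+ 1))) refl L ⟩
      - (L + 1#)                         ∎
      where L = fromℕ l

    closeʳ-∷-twos : closeʳ (b ∷ replicate l 2#) ≡ b
    closeʳ-∷-twos = begin
      e₁₁ (steps (b ∷ replicate l 2#)) * e₂₁ (steps (b ∷ replicate l 2#))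
                                         ≡⟨ cong (λ X → e₁₁ X * e₂₁ X) (steps-∷-twos b l) ⟩
      corner b L * (corner b L - b + 1#) ≡⟨ cong (λ c → c * (c - b + 1#)) corner≡-1 ⟩
      - 1# * (- 1# - b + 1#)             ≡⟨ solve 1 (λ b → :- con (+ 1) :* (:- con (+ 1) :- b :+ con (+ 1))
                                                          := b) refl b ⟩
      b                                  ∎
      where L = fromℕ l

  -- For w the inverse of b - 1, - (b + 1#) * w is the residue t = -(b+1)/(b-1) of the paper.
  module _ {b w : R} (w-inverse : w * (b - 1#) ≡ 1#) where

    t*[b-1]≡-[b+1] : - (b + 1#) * w * (b - 1#) ≡ - (b + 1#)
    t*[b-1]≡-[b+1] = begin
      - (b + 1#) * w * (b - 1#)      ≡⟨ *-assoc (- (b + 1#)) w (b - 1#) ⟩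
      - (b + 1#) * (w * (b - 1#))    ≡⟨ cong (- (b + 1#) *_) w-inverse ⟩
      - (b + 1#) * 1#                ≡⟨ *-identityʳ (- (b + 1#)) ⟩
      - (b + 1#)                     ∎

    corner-sign : ∀ {L} → IsSign (corner b L) → L ≡ - 1# ⊎ L ≡ - (b + 1#) * w
    corner-sign {L} (inj₁ corner≡1) = inj₁ (inverseˡ-unique L 1# (begin
      L + 1#                               ≡⟨ *-identityʳ (L + 1#) ⟨
      (L + 1#) * 1#                        ≡⟨ cong ((L + 1#) *_) w-inverse ⟨
      (L + 1#) * (w * (b - 1#))            ≡⟨ solve 3 (λ L b w → (L :+ con (+ 1)) :* (w :* (b :- con (+ 1)))
                                                := w :* ((L :+ con (+ 1)) :* b :- L :- con (+ 1))) refl L b w ⟩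
      w * (corner b L - 1#)                ≡⟨ cong (λ c → w * (c - 1#)) corner≡1 ⟩
      w * (1# - 1#)                        ≡⟨ solve 1 (λ w → w :* (con (+ 1) :- con (+ 1)) := con (+ 0)) refl w ⟩
      0#                                   ∎))
    corner-sign {L} (inj₂ corner≡-1) = inj₂ (x∙y⁻¹≈ε⇒x≈y L _ (begin
      L - - (b + 1#) * w                   ≡⟨ cong (_- - (b + 1#) * w) (*-identityʳ L) ⟨
      L * 1# - - (b + 1#) * w              ≡⟨ cong (λ z → L * z - - (b + 1#) * w) w-inverse ⟨
      L * (w * (b - 1#)) - - (b + 1#) * w  ≡⟨ solve 3 (λ L b w → L :* (w :* (b :- con (+ 1)))
                                                            :- :- (b :+ con (+ 1)) :* w
                                                := w :* ((L :+ con (+ 1)) :* b :- L :+ con (+ 1))) refl L b w ⟩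
      w * (corner b L + 1#)                ≡⟨ cong (λ c → w * (c + 1#)) corner≡-1 ⟩
      w * (- 1# + 1#)                      ≡⟨ solve 1 (λ w → w :* (:- con (+ 1) :+ con (+ 1)) := con (+ 0)) refl w ⟩
      0#                                   ∎))

    corner-t : corner b (- (b + 1#) * w) ≡ - 1#
    corner-t = begin
      corner b (- (b + 1#) * w)          ≡⟨ solve 2 (λ b w → (:- (b :+ con (+ 1)) :* w :+ con (+ 1)) :* b
                                                              :- :- (b :+ con (+ 1)) :* w
                                              := :- (b :+ con (+ 1)) :* w :* (b :- con (+ 1)) :+ b) refl b w ⟩
      - (b + 1#) * w * (b - 1#) + b      ≡⟨ cong (_+ b) t*[b-1]≡-[b+1] ⟩
      - (b + 1#) + b                     ≡⟨ solve 1 (λ b → :- (b :+ con (+ 1)) :+ b := :- con (+ 1)) refl b ⟩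
      - 1#                               ∎

    private
      balance : ∀ {c} → - (b + 1#) * w ≡ c → c * (b - 1#) - - (b + 1#) ≡ 0#
      balance t≡c = x≈y⇒x∙y⁻¹≈ε (trans (cong (_* (b - 1#)) (sym t≡c)) t*[b-1]≡-[b+1])

    t≡0⇒b≡-1 : - (b + 1#) * w ≡ 0# → b ≡ - 1#
    t≡0⇒b≡-1 t≡0 = begin
      b                                    ≡⟨ solve 1 (λ b → b := con (+ 0) :* (b :- con (+ 1))
                                                            :- :- (b :+ con (+ 1)) :- con (+ 1)) refl b ⟩
      0# * (b - 1#) - - (b + 1#) - 1#      ≡⟨ cong (_- 1#) (balance t≡0) ⟩
      0# - 1#                              ≡⟨ +-identityˡ (- 1#) ⟩
      - 1#                                 ∎

    t≡-1⇒2≡0 : - (b + 1#) * w ≡ - 1# → 2# ≡ 0#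
    t≡-1⇒2≡0 t≡-1 = begin
      2#                                   ≡⟨ solve 1 (λ b → con (+ 2)
                                                := :- con (+ 1) :* (b :- con (+ 1)) :- :- (b :+ con (+ 1))) refl b ⟩
      - 1# * (b - 1#) - - (b + 1#)         ≡⟨ balance t≡-1 ⟩
      0#                                   ∎

    t≡-2⇒b≡3 : - (b + 1#) * w ≡ - 2# → b ≡ 3#
    t≡-2⇒b≡3 t≡-2 = begin
      b                                    ≡⟨ solve 1 (λ b → b := con (+ 3)
                                                :- (:- con (+ 2) :* (b :- con (+ 1)) :- :- (b :+ con (+ 1)))) refl b ⟩
      3# - (- 2# * (b - 1#) - - (b + 1#))  ≡⟨ cong (λ z → 3# - z) (balance t≡-2) ⟩
      3# - 0#                              ≡⟨ solve 0 (con (+ 3) :- con (+ 0) := con (+ 3)) refl ⟩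
      3#                                   ∎

  t-at-three : ∀ {w} → w * (3# - 1#) ≡ 1# → - (3# + 1#) * w ≡ - 2#
  t-at-three {w} w-inverse = begin
    - (3# + 1#) * w          ≡⟨ solve 1 (λ w → :- (con (+ 3) :+ con (+ 1)) :* w
                                  := :- con (+ 2) :* (w :* (con (+ 3) :- con (+ 1)))) refl w ⟩
    - 2# * (w * (3# - 1#))   ≡⟨ cong (- 2# *_) w-inverse ⟩
    - 2# * 1#                ≡⟨ *-identityʳ (- 2#) ⟩
    - 2#                     ∎

  -[-2+1]≡1 : - (- 2# + 1#) ≡ 1#
  -[-2+1]≡1 = solve 0 (:- (:- con (+ 2) :+ con (+ 1)) := con (+ 1)) refl

  3-1≡2 : 3# - 1# ≡ 2#
  3-1≡2 = solve 0 (con (+ 3) :- con (+ 1) := con (+ 2)) refl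

  -+-cancelʳ : ∀ x y → x - y + y ≡ x
  -+-cancelʳ = solve 2 (λ x y → x :- y :+ y := x) refl

-- Cyclic words

module _ {A : Set} where

  ++-split : ∀ (xs ys zs ws : List A) → xs ++ ys ≡ zs ++ ws →
    (∃ λ ms → zs ≡ xs ++ ms × ys ≡ ms ++ ws) ⊎ (∃ λ ms → xs ≡ zs ++ ms × ws ≡ ms ++ ys)
  ++-split []       ys zs       ws eq = inj₁ (zs , refl , eq)
  ++-split (x ∷ xs) ys []       ws eq = inj₂ (x ∷ xs , refl , sym eq)
  ++-split (x ∷ xs) ys (z ∷ zs) ws eq with ∷-injective eq
  ... | refl , eq′ with ++-split xs ys zs ws eq′
  ...   | inj₁ (ms , refl , ys≡) = inj₁ (ms , refl , ys≡)
  ...   | inj₂ (ms , refl , ws≡) = inj₂ (ms , refl , ws≡)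

  ∷ʳ-split : ∀ (xs ys W : List A) x → xs ++ ys ≡ W ++ [ x ] →
    (ys ≡ [] × xs ≡ W ++ [ x ]) ⊎ (∃ λ zs → ys ≡ zs ++ [ x ] × W ≡ xs ++ zs)
  ∷ʳ-split []       ys W        x eq = inj₂ (W , eq , refl)
  ∷ʳ-split (a ∷ xs) ys []       x eq with ∷-injective eq
  ... | refl , xs++ys≡[] with xs | ys
  ...   | [] | [] = inj₁ (refl , refl)
  ∷ʳ-split (a ∷ xs) ys (w ∷ W)  x eq with ∷-injective eq
  ... | refl , eq′ with ∷ʳ-split xs ys W x eq′
  ...   | inj₁ (refl , refl)     = inj₁ (refl , refl)
  ...   | inj₂ (zs , ys≡ , refl) = inj₂ (zs , ys≡ , refl)

  record RotationAround (x : A) (W R : List A) : Set where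
    constructor rotationAround
    field
      W₁ W₂     : List A
      W≡W₁++W₂  : W ≡ W₁ ++ W₂
      R≡W₂++xW₁ : R ≡ W₂ ++ x ∷ W₁

  rotation-∷ : ∀ k x (W : List A) → RotationAround x W (drop k (x ∷ W) ++ take k (x ∷ W))
  rotation-∷ zero    x W = rotationAround W [] (sym (++-identityʳ W)) (++-identityʳ (x ∷ W))
  rotation-∷ (suc k) x W = rotationAround (take k W) (drop k W) (sym (take++drop≡id k W)) refl

  rotation-∷ʳ : ∀ k x (W : List A) → RotationAround x W (drop k (W ++ [ x ]) ++ take k (W ++ [ x ]))
  rotation-∷ʳ k x W with ∷ʳ-split (take k (W ++ [ x ])) (drop k (W ++ [ x ])) W x (take++drop≡id k (W ++ [ x ]))
  ... | inj₁ (dropped≡[] , taken≡) = rotationAround [] W refl (cong₂ _++_ dropped≡[] taken≡)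
  ... | inj₂ (zs , dropped≡ , W≡) = rotationAround (take k (W ++ [ x ])) zs W≡
    (trans (cong (_++ take k (W ++ [ x ])) dropped≡) (++-assoc zs [ x ] (take k (W ++ [ x ]))))

  rotationAround-length : ∀ {x W u X v Y} → RotationAround x W (u ∷ X ++ v ∷ Y) →
    suc (length X ℕ.+ length Y) ≡ length W
  rotationAround-length {x} {W} {u} {X} {v} {Y} (rotationAround W₁ W₂ refl R≡) = ℕ.suc-injective (begin
    suc (suc (length X ℕ.+ length Y))  ≡⟨ cong suc (ℕ.+-suc (length X) (length Y)) ⟨
    suc (length X ℕ.+ suc (length Y))  ≡⟨ cong suc (length-++ X) ⟨
    length (u ∷ X ++ v ∷ Y)            ≡⟨ cong length R≡ ⟩
    length (W₂ ++ x ∷ W₁)              ≡⟨ length-++ W₂ ⟩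
    length W₂ ℕ.+ suc (length W₁)      ≡⟨ ℕ.+-suc (length W₂) (length W₁) ⟩
    suc (length W₂ ℕ.+ length W₁)      ≡⟨ cong suc (ℕ.+-comm (length W₂) (length W₁)) ⟩
    suc (length W₁ ℕ.+ length W₂)      ≡⟨ cong suc (length-++ W₁) ⟨
    suc (length (W₁ ++ W₂))            ∎)
    where open ≡-Reasoning

  InfixAfter : A → List A → List A → Set
  InfixAfter y S W = ∃₂ λ P Q → W ≡ P ++ y ∷ S ++ Q

  -- Of the two windows S and S′ of the cyclic word x W, one avoids x, and it sits in W right after
  -- its left neighbour.
  rotation-window : ∀ {x W₁ W₂ u S v S′} → W₂ ++ x ∷ W₁ ≡ u ∷ S ++ v ∷ S′ →
    InfixAfter v S′ (W₁ ++ W₂) ⊎ InfixAfter u S (W₁ ++ W₂)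
  rotation-window {x} {W₁} {W₂} {u} {S} {v} {S′} eq with ++-split W₂ (x ∷ W₁) (u ∷ S) (v ∷ S′) eq
  ... | inj₁ ([] , u∷S≡W₂++[] , _) = inj₂ (W₁ , [] , cong (W₁ ++_)
    (trans (sym (++-identityʳ W₂)) (trans (sym u∷S≡W₂++[]) (sym (++-identityʳ (u ∷ S))))))
  ... | inj₁ (_ ∷ ms , _ , x∷W₁≡) =
    inj₁ (ms , W₂ , trans (cong (_++ W₂) (∷-injectiveʳ x∷W₁≡)) (++-assoc ms (v ∷ S′) W₂))
  ... | inj₂ (ms , W₂≡ , _) = inj₂ (W₁ , ms , cong (W₁ ++_) W₂≡)

  infixAfter-∷ : ∀ {y S z L} → InfixAfter y S (z ∷ L) → ∃₂ λ P Q → L ≡ P ++ S ++ Q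
  infixAfter-∷         ([]    , Q , eq) = [] , Q , ∷-injectiveʳ eq
  infixAfter-∷ {y} {S} (_ ∷ P , Q , eq) =
    P ++ [ y ] , Q , trans (∷-injectiveʳ eq) (sym (++-assoc P [ y ] (S ++ Q)))

  module _ (c d : A) where

    prefix-of-replicate-∷ʳ : ∀ l S Q → replicate l c ++ [ d ] ≡ S ++ Q →
      (∃ λ k → S ≡ replicate k c) ⊎ (∃ λ j → S ≡ replicate j c ++ [ d ])
    prefix-of-replicate-∷ʳ l       []          Q eq = inj₁ (0 , refl)
    prefix-of-replicate-∷ʳ zero    (s ∷ [])    Q eq = inj₂ (0 , cong [_] (sym (∷-injectiveˡ eq)))
    prefix-of-replicate-∷ʳ zero    (s ∷ t ∷ S) Q eq with ∷-injectiveʳ eq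
    ... | ()
    prefix-of-replicate-∷ʳ (suc l) (s ∷ S)     Q eq with ∷-injective eq
    ... | refl , eq′ with prefix-of-replicate-∷ʳ l S Q eq′
    ...   | inj₁ (k , refl) = inj₁ (suc k , refl)
    ...   | inj₂ (j , refl) = inj₂ (suc j , refl)

    infix-of-replicate-∷ʳ : ∀ l P S Q → replicate l c ++ [ d ] ≡ P ++ S ++ Q →
      (∃ λ k → S ≡ replicate k c) ⊎ (∃ λ j → S ≡ replicate j c ++ [ d ])
    infix-of-replicate-∷ʳ l       []      S Q eq = prefix-of-replicate-∷ʳ l S Q eq
    infix-of-replicate-∷ʳ zero    (p ∷ P) S Q eq with P | S | ∷-injectiveʳ eq
    ... | [] | [] | _ = inj₁ (0 , refl)
    infix-of-replicate-∷ʳ (suc l) (p ∷ P) S Q eq = infix-of-replicate-∷ʳ l P S Q (∷-injectiveʳ eq)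

  replicate-∷ʳ : ∀ l (c : A) → replicate l c ++ [ c ] ≡ c ∷ replicate l c
  replicate-∷ʳ zero    c = refl
  replicate-∷ʳ (suc l) c = cong (c ∷_) (replicate-∷ʳ l c)

  reverse-replicate : ∀ l (c : A) → reverse (replicate l c) ≡ replicate l c
  reverse-replicate zero    c = refl
  reverse-replicate (suc l) c = begin
    reverse (c ∷ replicate l c)      ≡⟨ unfold-reverse c (replicate l c) ⟩
    reverse (replicate l c) ++ [ c ] ≡⟨ cong (_++ [ c ]) (reverse-replicate l c) ⟩
    replicate l c ++ [ c ]           ≡⟨ replicate-∷ʳ l c ⟩
    c ∷ replicate l c                ∎
    where open ≡-Reasoning

  reverse-framed-replicate : ∀ l (b c : A) → reverse (b ∷ replicate l c ++ [ b ]) ≡ b ∷ replicate l c ++ [ b ]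
  reverse-framed-replicate l b c = begin
    reverse (b ∷ replicate l c ++ [ b ])       ≡⟨ unfold-reverse b (replicate l c ++ [ b ]) ⟩
    reverse (replicate l c ++ [ b ]) ++ [ b ]  ≡⟨ cong (_++ [ b ]) (reverse-++ (replicate l c) [ b ]) ⟩
    b ∷ reverse (replicate l c) ++ [ b ]       ≡⟨ cong (λ L → b ∷ L ++ [ b ]) (reverse-replicate l c) ⟩
    b ∷ replicate l c ++ [ b ]                 ∎
    where open ≡-Reasoning

  length-replicate-∷ʳ : ∀ l {c d : A} → length (replicate l c ++ [ d ]) ≡ suc l
  length-replicate-∷ʳ l {c} =
    trans (length-++ (replicate l c)) (trans (cong (ℕ._+ 1) (length-replicate l)) (ℕ.+-comm l 1))

  length-window : ∀ {X Y : List A} {l} → length X ℕ.+ length Y ≡ suc l → Y ≢ [] → length X ≤ l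
  length-window {Y = []}    _  Y≢[] = contradiction refl Y≢[]
  length-window {X} {_ ∷ Y} eq _    = ℕ.≤-pred (subst (suc (length X) ≤_) eq (ℕ.m<m+n (length X) (s≤s z≤n)))

  ∷ʳ≢[] : ∀ (xs : List A) {y} → xs ++ [ y ] ≢ []
  ∷ʳ≢[] []      ()
  ∷ʳ≢[] (_ ∷ _) ()

  ∷-as-∷ʳ : ∀ (x : A) xs → ∃₂ λ ys y → x ∷ xs ≡ ys ++ [ y ]
  ∷-as-∷ʳ x []        = [] , x , refl
  ∷-as-∷ʳ x (x′ ∷ xs) with ∷-as-∷ʳ x′ xs
  ... | ys , y , eq = x ∷ ys , y , cong (x ∷_) eq

  3≤length⇒ends : ∀ {xs : List A} → 3 ≤ length xs → ∃ λ x₁ → ∃₂ λ X xₙ → X ≢ [] × xs ≡ x₁ ∷ X ++ [ xₙ ]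
  3≤length⇒ends {_ ∷ []}         (s≤s ())
  3≤length⇒ends {_ ∷ _ ∷ []}     (s≤s (s≤s ()))
  3≤length⇒ends {x ∷ y ∷ z ∷ zs} _ with ∷-as-∷ʳ y (z ∷ zs)
  ... | []     , _  , eq with ∷-injectiveʳ eq
  ...   | ()
  3≤length⇒ends {x ∷ y ∷ z ∷ zs} _ | m ∷ ms , xₙ , eq = x , m ∷ ms , xₙ , (λ ()) , cong (x ∷_) eq

  ends⇒3≤length : ∀ x₁ {X : List A} xₙ → X ≢ [] → 3 ≤ length (x₁ ∷ X ++ [ xₙ ])
  ends⇒3≤length x₁ {[]}    xₙ X≢[] = contradiction refl X≢[]
  ends⇒3≤length x₁ {m ∷ X} xₙ _    = s≤s (s≤s (subst (1 ≤_) (sym (length-++ X)) (ℕ.m≤n+m 1 (length X))))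

<⇒≤∸1 : ∀ {m n} → m < n → m ≤ n ∸ 1
<⇒≤∸1 {m} {n} m<n = subst (m ≤_) (ℕ.pred[m∸n]≡m∸[1+n] n 0) (ℕ.<⇒≤pred m<n)

least-witness : ∀ {P : ℕ → Set} → Decidable P → ∀ {n} → P n → ∃ λ m → P m × ∀ {k} → P k → m ≤ k
least-witness {P} P? = <-rec (λ n → P n → Least) search _
  where
  Least = ∃ λ m → P m × ∀ {k} → P k → m ≤ k
  search : ∀ n → (∀ {k} → k < n → P k → Least) → P n → Least
  search n smaller Pn with ℕ.anyUpTo? P? n
  ... | yes (k , k<n , Pk) = smaller k<n Pk
  ... | no  ∄k<n           = n , Pn , λ {k} Pk → ℕ.≮⇒≥ (λ k<n → ∄k<n (k , k<n , Pk))

-- Residues modulo p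

open import Data.Nat using (_+_; _*_)

-- Implicit arguments are often supplied by hand below, and towedSolution is opaque: otherwise
-- unification unfolds the modular arithmetic inside the entries of matrix products, which is
-- prohibitively slow.
module Residues (p : ℕ) {{_ : NonZero p}} where
  open ZMod p renaming (_+ₚ_ to infixl 6 _+ₚ_; _*ₚ_ to infixl 7 _*ₚ_; -ₚ_ to infix 8 -ₚ_; _-ₚ_ to infixl 6 _-ₚ_)
  open ≡-Reasoning

  toℕ-cls : ∀ m → toℕ (cls m) ≡ m % p
  toℕ-cls m = toℕ-fromℕ< (m%n<n m p)

  cls-≡ : ∀ {m n} → m % p ≡ n % p → cls m ≡ cls n
  cls-≡ {m} {n} e = toℕ-injective (trans (toℕ-cls m) (trans e (sym (toℕ-cls n))))

  cls-toℕ : ∀ a → cls (toℕ a) ≡ a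
  cls-toℕ a = toℕ-injective (trans (toℕ-cls (toℕ a)) (m<n⇒m%n≡m (toℕ<n a)))

  cls-+ : ∀ m n → cls (m + n) ≡ cls m +ₚ cls n
  cls-+ m n = cls-≡ (trans (%-distribˡ-+ m n p) (sym (cong₂ (λ u v → (u + v) % p) (toℕ-cls m) (toℕ-cls n))))

  cls-* : ∀ m n → cls (m * n) ≡ cls m *ₚ cls n
  cls-* m n = cls-≡ (trans (%-distribˡ-* m n p) (sym (cong₂ (λ u v → (u * v) % p) (toℕ-cls m) (toℕ-cls n))))

  cls-p : cls p ≡ 0ₚ
  cls-p = cls-≡ (trans (n%n≡0 p) (sym (m<n⇒m%n≡m (ℕ.>-nonZero⁻¹ p))))

  cls-surjective-elim : {P : Zp → Set} → (∀ m → P (cls m)) → ∀ a → P a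
  cls-surjective-elim {P} h a = subst P (cls-toℕ a) (h (toℕ a))

  +ₚ-assoc : ∀ a b c → (a +ₚ b) +ₚ c ≡ a +ₚ (b +ₚ c)
  +ₚ-assoc = cls-surjective-elim λ m → cls-surjective-elim λ n → cls-surjective-elim λ k → begin
    (cls m +ₚ cls n) +ₚ cls k  ≡⟨ cong (_+ₚ cls k) (cls-+ m n) ⟨
    cls (m + n) +ₚ cls k       ≡⟨ cls-+ (m + n) k ⟨
    cls (m + n + k)            ≡⟨ cong cls (ℕ.+-assoc m n k) ⟩
    cls (m + (n + k))          ≡⟨ cls-+ m (n + k) ⟩
    cls m +ₚ cls (n + k)       ≡⟨ cong (cls m +ₚ_) (cls-+ n k) ⟩
    cls m +ₚ (cls n +ₚ cls k)  ∎

  *ₚ-assoc : ∀ a b c → (a *ₚ b) *ₚ c ≡ a *ₚ (b *ₚ c)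
  *ₚ-assoc = cls-surjective-elim λ m → cls-surjective-elim λ n → cls-surjective-elim λ k → begin
    (cls m *ₚ cls n) *ₚ cls k  ≡⟨ cong (_*ₚ cls k) (cls-* m n) ⟨
    cls (m * n) *ₚ cls k       ≡⟨ cls-* (m * n) k ⟨
    cls (m * n * k)            ≡⟨ cong cls (ℕ.*-assoc m n k) ⟩
    cls (m * (n * k))          ≡⟨ cls-* m (n * k) ⟩
    cls m *ₚ cls (n * k)       ≡⟨ cong (cls m *ₚ_) (cls-* n k) ⟩
    cls m *ₚ (cls n *ₚ cls k)  ∎

  *ₚ-distribʳ-+ₚ : ∀ a b c → (b +ₚ c) *ₚ a ≡ (b *ₚ a) +ₚ (c *ₚ a)
  *ₚ-distribʳ-+ₚ = cls-surjective-elim λ m → cls-surjective-elim λ n → cls-surjective-elim λ k → begin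
    (cls n +ₚ cls k) *ₚ cls m             ≡⟨ cong (_*ₚ cls m) (cls-+ n k) ⟨
    cls (n + k) *ₚ cls m                  ≡⟨ cls-* (n + k) m ⟨
    cls ((n + k) * m)                     ≡⟨ cong cls (ℕ.*-distribʳ-+ m n k) ⟩
    cls (n * m + k * m)                   ≡⟨ cls-+ (n * m) (k * m) ⟩
    cls (n * m) +ₚ cls (k * m)            ≡⟨ cong₂ _+ₚ_ (cls-* n m) (cls-* k m) ⟩
    (cls n *ₚ cls m) +ₚ (cls k *ₚ cls m)  ∎

  +ₚ-comm : ∀ a b → a +ₚ b ≡ b +ₚ a
  +ₚ-comm a b = cong cls (ℕ.+-comm (toℕ a) (toℕ b))

  *ₚ-comm : ∀ a b → a *ₚ b ≡ b *ₚ a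
  *ₚ-comm a b = cong cls (ℕ.*-comm (toℕ a) (toℕ b))

  +ₚ-identityˡ : ∀ a → 0ₚ +ₚ a ≡ a
  +ₚ-identityˡ = cls-surjective-elim λ m → sym (cls-+ 0 m)

  *ₚ-identityˡ : ∀ a → 1ₚ *ₚ a ≡ a
  *ₚ-identityˡ = cls-surjective-elim λ m → trans (sym (cls-* 1 m)) (cong cls (ℕ.*-identityˡ m))

  -ₚ-inverseʳ : ∀ a → a +ₚ (-ₚ a) ≡ 0ₚ
  -ₚ-inverseʳ a = begin
    a +ₚ (-ₚ a)                        ≡⟨ cong (_+ₚ (-ₚ a)) (cls-toℕ a) ⟨
    cls (toℕ a) +ₚ cls (p ∸ toℕ a)     ≡⟨ cls-+ (toℕ a) (p ∸ toℕ a) ⟨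
    cls (toℕ a + (p ∸ toℕ a))          ≡⟨ cong cls (ℕ.m+[n∸m]≡n (ℕ.<⇒≤ (toℕ<n a))) ⟩
    cls p                              ≡⟨ cls-p ⟩
    0ₚ                                 ∎

  isCommutativeRing : IsCommutativeRing _≡_ _+ₚ_ _*ₚ_ -ₚ_ 0ₚ 1ₚ
  isCommutativeRing = record
    { isRing = record
      { +-isAbelianGroup = record
        { isGroup = record
          { isMonoid = record
            { isSemigroup = record
              { isMagma = record { isEquivalence = isEquivalence ; ∙-cong = cong₂ _+ₚ_ }
              ; assoc = +ₚ-assoc }
            ; identity = +ₚ-identityˡ , λ a → trans (+ₚ-comm a 0ₚ) (+ₚ-identityˡ a) }
          ; inverse = (λ a → trans (+ₚ-comm (-ₚ a) a) (-ₚ-inverseʳ a)) , -ₚ-inverseʳ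
          ; ⁻¹-cong = cong (-ₚ_) }
        ; comm = +ₚ-comm }
      ; *-cong = cong₂ _*ₚ_
      ; *-assoc = *ₚ-assoc
      ; *-identity = *ₚ-identityˡ , λ a → trans (*ₚ-comm a 1ₚ) (*ₚ-identityˡ a)
      ; distrib = (λ a b c → trans (*ₚ-comm a (b +ₚ c))
                    (trans (*ₚ-distribʳ-+ₚ a b c) (cong₂ _+ₚ_ (*ₚ-comm b a) (*ₚ-comm c a))))
                , *ₚ-distribʳ-+ₚ }
      ; *-comm = *ₚ-comm }

  open OverCommutativeRing isCommutativeRing public
  open CommutativeRing commutativeRing using (+-identityʳ; zeroʳ; +-abelianGroup; ring)
  open AbelianGroupProperties +-abelianGroup using (inverseˡ-unique; inverseʳ-unique; x∙y⁻¹≈ε⇒x≈y; ⁻¹-injective)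
  open RingProperties ring using (-‿distribˡ-*; -‿involutive; -0#≈0#)

  cls≡fromℕ : ∀ n → cls n ≡ fromℕ n
  cls≡fromℕ zero    = refl
  cls≡fromℕ (suc n) = begin
    cls (suc n)         ≡⟨ cong cls (ℕ.+-comm 1 n) ⟩
    cls (n + 1)         ≡⟨ cls-+ n 1 ⟩
    cls n +ₚ 1ₚ         ≡⟨ cong (_+ₚ 1ₚ) (cls≡fromℕ n) ⟩
    fromℕ n +ₚ 1ₚ       ≡⟨ fromℕ-suc n ⟨
    fromℕ (suc n)       ∎

  toℕ-cls-< : ∀ {k} → k < p → toℕ (cls k) ≡ k
  toℕ-cls-< {k} k<p = trans (toℕ-cls k) (m<n⇒m%n≡m k<p)

  cls≡⇒≤ : ∀ {k a} → cls k ≡ a → toℕ a ≤ k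
  cls≡⇒≤ {k} refl = subst (_≤ k) (sym (toℕ-cls k)) (m%n≤m k p)

  cls≡cls⇒≤ : ∀ {k m} → m < p → cls k ≡ cls m → m ≤ k
  cls≡cls⇒≤ m<p eq = subst (_≤ _) (toℕ-cls-< m<p) (cls≡⇒≤ eq)

  cls≡0⇒p≤ : ∀ {k} → 1 ≤ k → cls k ≡ 0ₚ → p ≤ k
  cls≡0⇒p≤ {k} 1≤k clsk≡0 with ℕ.<-≤-connex k p
  ... | inj₂ p≤k = p≤k
  ... | inj₁ k<p = contradiction k≡0 (ℕ.>⇒≢ 1≤k)
    where
    k≡0 : k ≡ 0
    k≡0 = trans (sym (toℕ-cls-< k<p)) (trans (cong toℕ clsk≡0) (toℕ-cls-< (ℕ.>-nonZero⁻¹ p)))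

  toℕ≢0 : ∀ {a} → a ≢ 0ₚ → toℕ a ≢ 0
  toℕ≢0 {a} a≢0 toℕa≡0 = a≢0 (trans (sym (cls-toℕ a)) (cong cls toℕa≡0))

  b-1≢0 : ∀ {b} → b ≢ 1ₚ → b -ₚ 1ₚ ≢ 0ₚ
  b-1≢0 {b} b≢1 b-1≡0 = b≢1 (x∙y⁻¹≈ε⇒x≈y b 1ₚ b-1≡0)

  cls-p∸ : ∀ {n} → n ≤ p → cls (p ∸ n) ≡ -ₚ cls n
  cls-p∸ {n} n≤p = inverseˡ-unique (cls (p ∸ n)) (cls n) (begin
    cls (p ∸ n) +ₚ cls n     ≡⟨ cls-+ (p ∸ n) n ⟨
    cls (p ∸ n + n)          ≡⟨ cong cls (ℕ.m∸n+n≡m n≤p) ⟩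
    cls p                    ≡⟨ cls-p ⟩
    0ₚ                       ∎)

  cls-*-toℕ : ∀ y a → cls (y * toℕ a) ≡ cls y *ₚ a
  cls-*-toℕ y a = trans (cls-* y (toℕ a)) (cong (cls y *ₚ_) (cls-toℕ a))

  cls-*p : ∀ x → cls (x * p) ≡ 0ₚ
  cls-*p x = trans (cls-* x p) (trans (cong (cls x *ₚ_) cls-p) (zeroʳ (cls x)))

  inverse : Prime p → ∀ {a} → a ≢ 0ₚ → ∃ λ w → w *ₚ a ≡ 1ₚ
  inverse p-prime {a} a≢0 with coprime-Bézout (prime⇒coprime p-prime {{≢-nonZero (toℕ≢0 a≢0)}} (toℕ<n a))
  ... | Bézout.-+ x y eq = cls y , (begin
    cls y *ₚ a          ≡⟨ cls-*-toℕ y a ⟨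
    cls (y * toℕ a)     ≡⟨ cong cls eq ⟨
    cls (1 + x * p)     ≡⟨ cls-+ 1 (x * p) ⟩
    1ₚ +ₚ cls (x * p)   ≡⟨ cong (1ₚ +ₚ_) (cls-*p x) ⟩
    1ₚ +ₚ 0ₚ            ≡⟨ +-identityʳ 1ₚ ⟩
    1ₚ                  ∎)
  ... | Bézout.+- x y eq = -ₚ cls y , (begin
    -ₚ cls y *ₚ a       ≡⟨ -‿distribˡ-* (cls y) a ⟨
    -ₚ (cls y *ₚ a)     ≡⟨ cong -ₚ_ (inverseʳ-unique 1ₚ (cls y *ₚ a) 1+ya≡0) ⟩
    -ₚ -ₚ 1ₚ            ≡⟨ -‿involutive 1ₚ ⟩
    1ₚ                  ∎)
    where
    1+ya≡0 : 1ₚ +ₚ cls y *ₚ a ≡ 0ₚ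
    1+ya≡0 = begin
      1ₚ +ₚ cls y *ₚ a        ≡⟨ cong (1ₚ +ₚ_) (cls-*-toℕ y a) ⟨
      1ₚ +ₚ cls (y * toℕ a)   ≡⟨ cls-+ 1 (y * toℕ a) ⟨
      cls (1 + y * toℕ a)     ≡⟨ cong cls eq ⟩
      cls (x * p)             ≡⟨ cls-*p x ⟩
      0ₚ                      ∎

  toMat : Matrix Zp → Mat
  toMat (matrix a b c d) = mat a b c d

  toMat-injective : ∀ {X Y} → toMat X ≡ toMat Y → X ≡ Y
  toMat-injective {matrix _ _ _ _} {matrix _ _ _ _} refl = refl

  M≡toMat∘steps : ∀ cs → M cs ≡ toMat (steps cs)
  M≡toMat∘steps []       = refl
  M≡toMat∘steps (c ∷ cs) = cong (_⊗ A c) (M≡toMat∘steps cs)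

  solution⇒isSolution : ∀ cs → Solution cs → IsSolution cs
  solution⇒isSolution cs (inj₁ M≡Id)  =
    solution (inj₁ refl) (toMat-injective (trans (sym (M≡toMat∘steps cs)) M≡Id))
  solution⇒isSolution cs (inj₂ M≡-Id) =
    solution (inj₂ refl) (toMat-injective (trans (sym (M≡toMat∘steps cs)) M≡-Id))

  isSolution⇒solution : ∀ {cs} → IsSolution cs → Solution cs
  isSolution⇒solution {cs} (solution (inj₁ refl) steps≡) = inj₁ (trans (M≡toMat∘steps cs) (cong toMat steps≡))
  isSolution⇒solution {cs} (solution (inj₂ refl) steps≡) = inj₂ (trans (M≡toMat∘steps cs) (cong toMat steps≡))

  extendable? : ∀ S → Dec (Extendable S)
  extendable? S =
    map′ extendable Extendable.isSign ((e₁₁ (steps S) Fin.≟ 1ₚ) ⊎-dec (e₁₁ (steps S) Fin.≟ -ₚ 1ₚ))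

  replicate-2ₚ : ∀ l → replicate l 2ₚ ≡ replicate l 2#
  replicate-2ₚ l = cong (replicate l) (cls≡fromℕ 2)

  e₁₁-steps-∷-2ₚs : ∀ b l → e₁₁ (steps (b ∷ replicate l 2ₚ)) ≡ corner b (cls l)
  e₁₁-steps-∷-2ₚs b l = begin
    e₁₁ (steps (b ∷ replicate l 2ₚ))    ≡⟨ cong (λ S → e₁₁ (steps (b ∷ S))) (replicate-2ₚ l) ⟩
    e₁₁ (steps (b ∷ replicate l 2#))    ≡⟨ cong e₁₁ (steps-∷-twos b l) ⟩
    corner b (fromℕ l)                  ≡⟨ cong (corner b) (cls≡fromℕ l) ⟨
    corner b (cls l)                    ∎

  e₁₁-steps-2ₚs-∷ʳ : ∀ b l → e₁₁ (steps (replicate l 2ₚ ++ [ b ])) ≡ corner b (cls l)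
  e₁₁-steps-2ₚs-∷ʳ b l = begin
    e₁₁ (steps (replicate l 2ₚ ++ [ b ]))  ≡⟨ cong (λ S → e₁₁ (steps (S ++ [ b ]))) (replicate-2ₚ l) ⟩
    e₁₁ (steps (replicate l 2# ++ [ b ]))  ≡⟨ e₁₁-steps-twos-∷ʳ b l ⟩
    corner b (fromℕ l)                     ≡⟨ cong (corner b) (cls≡fromℕ l) ⟨
    corner b (cls l)                       ∎

  e₁₁-steps-2ₚs : ∀ l → e₁₁ (steps (replicate l 2ₚ)) ≡ cls l +ₚ 1ₚ
  e₁₁-steps-2ₚs l = begin
    e₁₁ (steps (replicate l 2ₚ))   ≡⟨ cong (λ S → e₁₁ (steps S)) (replicate-2ₚ l) ⟩
    e₁₁ (steps (replicate l 2#))   ≡⟨ e₁₁-steps-twos l ⟩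
    fromℕ l +ₚ 1ₚ                  ≡⟨ cong (_+ₚ 1ₚ) (cls≡fromℕ l) ⟨
    cls l +ₚ 1ₚ                    ∎

  module _ {b l} (corner≡-1 : corner b (cls l) ≡ -ₚ 1ₚ) where

    private
      corner-fromℕ≡-1 : corner b (fromℕ l) ≡ -ₚ 1ₚ
      corner-fromℕ≡-1 = trans (cong (corner b) (sym (cls≡fromℕ l))) corner≡-1

    closeˡ-∷-2ₚs : closeˡ (b ∷ replicate l 2ₚ) ≡ -ₚ cls (l + 1)
    closeˡ-∷-2ₚs = begin
      closeˡ (b ∷ replicate l 2ₚ)   ≡⟨ cong (λ S → closeˡ (b ∷ S)) (replicate-2ₚ l) ⟩
      closeˡ (b ∷ replicate l 2#)   ≡⟨ closeˡ-∷-twos l corner-fromℕ≡-1 ⟩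
      -ₚ (fromℕ l +ₚ 1ₚ)            ≡⟨ cong (λ L → -ₚ (L +ₚ 1ₚ)) (cls≡fromℕ l) ⟨
      -ₚ (cls l +ₚ 1ₚ)              ≡⟨ cong -ₚ_ (cls-+ l 1) ⟨
      -ₚ cls (l + 1)                ∎

    closeʳ-∷-2ₚs : closeʳ (b ∷ replicate l 2ₚ) ≡ b
    closeʳ-∷-2ₚs = trans (cong (λ S → closeʳ (b ∷ S)) (replicate-2ₚ l)) (closeʳ-∷-twos l corner-fromℕ≡-1)

  opaque
    towedSolution : Zp → ℕ → List Zp
    towedSolution b l = towed (closeˡ (b ∷ replicate l 2ₚ)) b l (closeʳ (b ∷ replicate l 2ₚ))

    towedSolution-≡ : ∀ b l →
      towedSolution b l ≡ towed (closeˡ (b ∷ replicate l 2ₚ)) b l (closeʳ (b ∷ replicate l 2ₚ))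
    towedSolution-≡ b l = refl

  towedSol⇒ : ∀ {b l cs} → TowedSol b l cs → Extendable (b ∷ replicate l 2ₚ) × cs ≡ towedSolution b l
  towedSol⇒ {b} {l} (_ , x , y , refl , sol)
    with solution⇒extendable {x} {b ∷ replicate l 2ₚ} {y} (solution⇒isSolution (towed x b l y) sol)
  ... | ext , refl , refl = ext , sym (towedSolution-≡ b l)

  towedSol⇐ : ∀ {b l} → 1 ≤ l → Extendable (b ∷ replicate l 2ₚ) → TowedSol b l (towedSolution b l)
  towedSol⇐ {b} {l} 1≤l ext =
    1≤l , closeˡ (b ∷ replicate l 2ₚ) , closeʳ (b ∷ replicate l 2ₚ) , towedSolution-≡ b l ,
    subst Solution (sym (towedSolution-≡ b l)) (isSolution⇒solution (extendable⇒solution ext))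

  IsMinimalTowLength : Zp → ℕ → Set
  IsMinimalTowLength b l =
    (1 ≤ l × Extendable (b ∷ replicate l 2ₚ)) × (∀ {l′} → 1 ≤ l′ × Extendable (b ∷ replicate l′ 2ₚ) → l ≤ l′)

  minimalTowLength-unique : ∀ {b l l′} → IsMinimalTowLength b l → IsMinimalTowLength b l′ → l ≡ l′
  minimalTowLength-unique (valid , minimal) (valid′ , minimal′) = ℕ.≤-antisym (minimal valid′) (minimal′ valid)

  minimalTowLength : 1 < p → ∀ b → ∃ (IsMinimalTowLength b)
  minimalTowLength 1<p b = least-witness (λ l → (1 ℕ.≤? l) ×-dec extendable? (b ∷ replicate l 2ₚ)) {p ∸ 1}
    (ℕ.∸-monoˡ-≤ 1 1<p , extendable (inj₁ corner≡1))
    where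
    corner≡1 : e₁₁ (steps (b ∷ replicate (p ∸ 1) 2ₚ)) ≡ 1ₚ
    corner≡1 = trans (e₁₁-steps-∷-2ₚs b (p ∸ 1))
      (trans (cong (corner b) (cls-p∸ (ℕ.<⇒≤ 1<p))) (corner-at-minus-one b))

  towedMinimal : ∀ {b l} → IsMinimalTowLength b l → TowedMinimal b (towedSolution b l)
  towedMinimal {b} {l} ((1≤l , ext) , minimal) = l , towedSol⇐ {b} {l} 1≤l ext ,
    λ l′ ds towedSol → minimal {l′} (proj₁ towedSol , proj₁ (towedSol⇒ {b} {l′} {ds} towedSol))

  towedMinimal⇒ : ∀ {b T} → TowedMinimal b T → ∃ λ l → IsMinimalTowLength b l × T ≡ towedSolution b l
  towedMinimal⇒ {b} {T} (l , towedSol , minimal) with towedSol⇒ {b} {l} {T} towedSol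
  ... | ext , T≡ = l , ((proj₁ towedSol , ext) , minimal′) , T≡
    where
    minimal′ : ∀ {l′} → 1 ≤ l′ × Extendable (b ∷ replicate l′ 2ₚ) → l ≤ l′
    minimal′ {l′} (1≤l′ , ext′) = minimal l′ (towedSolution b l′) (towedSol⇐ {b} {l′} 1≤l′ ext′)

  towedMinimal-unique : ∀ {b l T} → IsMinimalTowLength b l → TowedMinimal b T → T ≡ towedSolution b l
  towedMinimal-unique {b} {l} {T} minimal towedMin =
    let l′ , minimal′ , T≡ = towedMinimal⇒ {b} {T} towedMin
    in trans T≡ (cong (towedSolution b) (minimalTowLength-unique {b} {l′} {l} minimal′ minimal))

  initL-∷ʳ : ∀ xs z → initL (xs ++ [ z ]) ≡ xs
  initL-∷ʳ []           z = refl
  initL-∷ʳ (x ∷ [])     z = refl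
  initL-∷ʳ (x ∷ y ∷ xs) z = cong (x ∷_) (initL-∷ʳ (y ∷ xs) z)

  lastD-∷ʳ : ∀ d xs z → lastD d (xs ++ [ z ]) ≡ z
  lastD-∷ʳ d []       z = refl
  lastD-∷ʳ d (x ∷ xs) z = lastD-∷ʳ x xs z

  ⊕-∷ʳ : ∀ a₁ A aₙ b₁ B bₘ → (a₁ ∷ A ++ [ aₙ ]) ⊕ (b₁ ∷ B ++ [ bₘ ]) ≡ (a₁ +ₚ bₘ) ∷ A ++ (aₙ +ₚ b₁) ∷ B
  ⊕-∷ʳ a₁ A aₙ b₁ B bₘ rewrite lastD-∷ʳ b₁ B bₘ | initL-∷ʳ A aₙ | lastD-∷ʳ a₁ A aₙ | initL-∷ʳ B bₘ = refl

  ∼⇒rotationAround : ∀ {x W R} → reverse W ≡ W → (x ∷ W) ∼ R → RotationAround x W R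
  ∼⇒rotationAround {x} {W} _          (inj₁ (k , refl)) = rotation-∷ k x W
  ∼⇒rotationAround {x} {W} palindrome (inj₂ (k , refl)) =
    subst (λ L → RotationAround x W (drop k L ++ take k L)) (sym reverse≡) (rotation-∷ʳ k x W)
    where
    reverse≡ : reverse (x ∷ W) ≡ W ++ [ x ]
    reverse≡ = trans (unfold-reverse x W) (cong (_++ [ x ]) palindrome)

  -- The extendable window S′ closes up into a solution B, and what remains is an A with
  -- A ⊕ B = u ∷ S ++ v ∷ S′.
  reducible-by-window : ∀ {T u S v S′} → T ∼ (u ∷ S ++ v ∷ S′) → S ≢ [] → S′ ≢ [] → Extendable S′ → Reducible T
  reducible-by-window {T} {u} {S} {v} {S′} T∼ S≢[] S′≢[] ext =
    as , bs ,
    ends⇒3≤length (u -ₚ closeʳ S′) (v -ₚ closeˡ S′) S≢[] , ends⇒3≤length (closeˡ S′) (closeʳ S′) S′≢[] ,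
    isSolution⇒solution {bs} (extendable⇒solution ext) , subst (T ∼_) (sym as⊕bs≡) T∼
    where
    as bs : List Zp
    as = (u -ₚ closeʳ S′) ∷ S ++ [ v -ₚ closeˡ S′ ]
    bs = closeˡ S′ ∷ S′ ++ [ closeʳ S′ ]
    as⊕bs≡ : as ⊕ bs ≡ u ∷ S ++ v ∷ S′
    as⊕bs≡ = trans (⊕-∷ʳ _ S _ _ S′ _) (cong₂ (λ a c → a ∷ S ++ c ∷ S′) (-+-cancelʳ u _) (-+-cancelʳ v _))

  reducible-if-second-sign : ∀ {x b l y} → IsSign b → 1 ≤ l → Reducible (towed x b l y)
  reducible-if-second-sign {x} {b} {suc k} {y} sign _ =
    reducible-by-window {towed x b (suc k) y} {2ₚ} {replicate k 2ₚ ++ [ y ]} {x} {[ b ]}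
      (inj₁ (2 , refl)) (∷ʳ≢[] (replicate k 2ₚ)) (λ ()) (extendable (subst IsSign (sym (e₁₁-steps-[ b ])) sign))

  reducible-if-first-sign : ∀ {x b l y} → IsSign x → 1 ≤ l → Reducible (towed x b l y)
  reducible-if-first-sign {x} {b} {suc k} {y} sign _ =
    reducible-by-window {towed x b (suc k) y} {b} {replicate (suc k) 2ₚ} {y} {[ x ]}
      (inj₁ (1 , sym (++-assoc (b ∷ replicate (suc k) 2ₚ) [ y ] [ x ]))) (λ ()) (λ ())
      (extendable (subst IsSign (sym (e₁₁-steps-[ x ])) sign))

  module _ {b l} (twos-inextendable : ∀ {k} → 1 ≤ k → k ≤ l → ¬ Extendable (replicate k 2ₚ))
                 (twos-b-inextendable : ∀ {j} → j < l → ¬ Extendable (replicate j 2ₚ ++ [ b ])) where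

    window-inextendable : ∀ {y S} → InfixAfter y S (b ∷ replicate l 2ₚ ++ [ b ]) → S ≢ [] → length S ≤ l →
      ¬ Extendable S
    window-inextendable {S = S} after S≢[] |S|≤l with infixAfter-∷ after
    ... | P , Q , eq with infix-of-replicate-∷ʳ 2ₚ b l P S Q eq
    ...   | inj₁ (zero  , refl) = contradiction refl S≢[]
    ...   | inj₁ (suc k , refl) = twos-inextendable (s≤s z≤n) (subst (_≤ l) (length-replicate (suc k)) |S|≤l)
    ...   | inj₂ (j     , refl) = twos-b-inextendable (subst (_≤ l) (length-replicate-∷ʳ j) |S|≤l)

    no-extendable-split : ∀ {x u A v B} → IsSolution (x ∷ b ∷ replicate l 2ₚ ++ [ b ]) →
      A ≢ [] → B ≢ [] → Extendable B → ¬ ((x ∷ b ∷ replicate l 2ₚ ++ [ b ]) ∼ (u ∷ A ++ v ∷ B))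
    no-extendable-split {x} {u} {A} {v} {B} T-solution A≢[] B≢[] B-extendable T∼R =
      [ (λ after → window-inextendable (subst (InfixAfter v B) (sym W≡W₁++W₂) after) B≢[]
                     (length-window {X = B} {Y = A} (trans (ℕ.+-comm (length B) (length A)) |A|+|B|≡) A≢[])
                     B-extendable)
      , (λ after → window-inextendable (subst (InfixAfter u A) (sym W≡W₁++W₂) after) A≢[]
                     (length-window {X = A} {Y = B} |A|+|B|≡ B≢[]) A-extendable)
      ]′ (rotation-window (sym R≡W₂++xW₁))
      where
      rotation : RotationAround x (b ∷ replicate l 2ₚ ++ [ b ]) (u ∷ A ++ v ∷ B)
      rotation = ∼⇒rotationAround (reverse-framed-replicate l b 2ₚ) T∼R
      open RotationAround rotation
      R-solution : IsSolution (u ∷ A ++ v ∷ B)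
      R-solution = subst IsSolution (sym R≡W₂++xW₁)
        (solution-rotate (x ∷ W₁) W₂ (subst (λ W → IsSolution (x ∷ W)) W≡W₁++W₂ T-solution))
      A-extendable : Extendable A
      A-extendable = extendable-complement u A v B R-solution B-extendable
      |A|+|B|≡ : length A + length B ≡ suc l
      |A|+|B|≡ = ℕ.suc-injective (trans (rotationAround-length rotation) (cong suc (length-replicate-∷ʳ l)))

    irreducible-by-windows : ∀ {x} → IsSolution (x ∷ b ∷ replicate l 2ₚ ++ [ b ]) →
      Irreducible (x ∷ b ∷ replicate l 2ₚ ++ [ b ])
    irreducible-by-windows {x} T-solution (as , bs , 3≤|as| , 3≤|bs| , bs-solution , T∼R)
      with 3≤length⇒ends {xs = as} 3≤|as| | 3≤length⇒ends {xs = bs} 3≤|bs|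
    ... | a₁ , A , aₙ , A≢[] , refl | b₁ , B , bₘ , B≢[] , refl =
      no-extendable-split T-solution A≢[] B≢[]
        (proj₁ (solution⇒extendable {b₁} {B} {bₘ} (solution⇒isSolution (b₁ ∷ B ++ [ bₘ ]) bs-solution)))
        (subst ((x ∷ b ∷ replicate l 2ₚ ++ [ b ]) ∼_) (⊕-∷ʳ a₁ A aₙ b₁ B bₘ) T∼R)

  module PrimeModulus (p-prime : Prime p) (3≤p : 3 ≤ p) where

    1<p : 1 < p
    1<p = ℕ.<-≤-trans (s≤s (s≤s z≤n)) 3≤p

    p∸1<p : p ∸ 1 < p
    p∸1<p = ℕ.∸-monoʳ-< (s≤s z≤n) (ℕ.<⇒≤ 1<p)

    p∸2<p : p ∸ 2 < p
    p∸2<p = ℕ.∸-monoʳ-< (s≤s z≤n) (ℕ.<⇒≤ 3≤p)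

    cls-p∸1 : cls (p ∸ 1) ≡ -ₚ 1ₚ
    cls-p∸1 = cls-p∸ (ℕ.<⇒≤ 1<p)

    cls-p∸2 : cls (p ∸ 2) ≡ -ₚ 2#
    cls-p∸2 = trans (cls-p∸ (ℕ.<⇒≤ 3≤p)) (cong -ₚ_ (cls≡fromℕ 2))

    2#≢0 : 2# ≢ 0ₚ
    2#≢0 2#≡0 = contradiction (begin
      2              ≡⟨ toℕ-cls-< 3≤p ⟨
      toℕ (cls 2)    ≡⟨ cong toℕ (trans (cls≡fromℕ 2) 2#≡0) ⟩
      toℕ (cls 0)    ≡⟨ toℕ-cls-< (ℕ.>-nonZero⁻¹ p) ⟩
      0              ∎) (λ ())

    -2#≢0 : -ₚ 2# ≢ 0ₚ
    -2#≢0 -2#≡0 = 2#≢0 (⁻¹-injective (trans -2#≡0 (sym -0#≈0#)))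

    record TowResidue (b : Zp) : Set where
      field
        w         : Zp
        w-inverse : w *ₚ (b -ₚ 1ₚ) ≡ 1ₚ
        t≢0       : -ₚ (b +ₚ 1ₚ) *ₚ w ≢ 0ₚ

      t : Zp
      t = -ₚ (b +ₚ 1ₚ) *ₚ w

      l₀ : ℕ
      l₀ = toℕ t

    towResidue : ∀ {b w} → w *ₚ (b -ₚ 1ₚ) ≡ 1ₚ → b ≢ -ₚ 1ₚ → TowResidue b
    towResidue {b} {w} w-inverse b≢-1 = record
      { w = w ; w-inverse = w-inverse ; t≢0 = λ t≡0 → b≢-1 (t≡0⇒b≡-1 {b} {w} w-inverse t≡0) }

    module _ {b} (τ : TowResidue b) where
      open TowResidue τ

      1≤l₀ : 1 ≤ l₀
      1≤l₀ = ℕ.n≢0⇒n>0 (toℕ≢0 t≢0)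

      l₀≤p∸2 : l₀ ≤ p ∸ 2
      l₀≤p∸2 = subst (l₀ ≤_) (ℕ.∸-+-assoc p 1 1) (<⇒≤∸1 (ℕ.≤∧≢⇒< (<⇒≤∸1 (toℕ<n t)) l₀≢p∸1))
        where
        l₀≢p∸1 : l₀ ≢ p ∸ 1
        l₀≢p∸1 l₀≡p∸1 = 2#≢0 (t≡-1⇒2≡0 w-inverse (trans (sym (cls-toℕ t)) (trans (cong cls l₀≡p∸1) cls-p∸1)))

      corner-l₀ : corner b (cls l₀) ≡ -ₚ 1ₚ
      corner-l₀ = trans (cong (corner b) (cls-toℕ t)) (corner-t w-inverse)

      minimal-l₀ : IsMinimalTowLength b l₀
      minimal-l₀ = (1≤l₀ , extendable (inj₂ (trans (e₁₁-steps-∷-2ₚs b l₀) corner-l₀))) , λ {l′} (_ , ext) →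
        [ (λ cls≡-1 → ℕ.≤-trans (<⇒≤∸1 (toℕ<n t)) (cls≡cls⇒≤ p∸1<p (trans cls≡-1 (sym cls-p∸1))))
        , cls≡⇒≤
        ]′ (corner-sign w-inverse (subst IsSign (e₁₁-steps-∷-2ₚs b l′) (Extendable.isSign ext)))

      towedSolution-l₀ : towedSolution b l₀ ≡ (-ₚ cls (l₀ + 1)) ∷ b ∷ (replicate l₀ 2ₚ ++ [ b ])
      towedSolution-l₀ = trans (towedSolution-≡ b l₀)
        (cong₂ (λ x y → towed x b l₀ y) (closeˡ-∷-2ₚs corner-l₀) (closeʳ-∷-2ₚs corner-l₀))

      module _ (b≢-1 : b ≢ -ₚ 1ₚ) (b≢1 : b ≢ 1ₚ) (b≢3 : b ≢ 3ₚ) where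

        twos-inextendable : ∀ {k} → 1 ≤ k → k ≤ l₀ → ¬ Extendable (replicate k 2ₚ)
        twos-inextendable {k} 1≤k k≤l₀ (extendable sign) =
          [ (λ cls≡0 → ℕ.<⇒≱ (ℕ.≤-<-trans (ℕ.≤-trans k≤l₀ l₀≤p∸2) p∸2<p) (cls≡0⇒p≤ 1≤k cls≡0))
          , (λ cls≡-2 → b≢3 (trans (t≡-2⇒b≡3 w-inverse (t≡-2 cls≡-2)) (sym (cls≡fromℕ 3))))
          ]′ (+1-sign (subst IsSign (e₁₁-steps-2ₚs k) sign))
          where
          t≡-2 : cls k ≡ -ₚ 2# → t ≡ -ₚ 2#
          t≡-2 cls≡-2 = trans (sym (cls-toℕ t)) (trans (cong cls l₀≡p∸2) cls-p∸2)
            where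
            l₀≡p∸2 : l₀ ≡ p ∸ 2
            l₀≡p∸2 = ℕ.≤-antisym l₀≤p∸2 (ℕ.≤-trans (cls≡cls⇒≤ p∸2<p (trans cls≡-2 (sym cls-p∸2))) k≤l₀)

        twos-b-inextendable : ∀ {j} → j < l₀ → ¬ Extendable (replicate j 2ₚ ++ [ b ])
        twos-b-inextendable {zero} _ (extendable sign) =
          [ b≢1 , b≢-1 ]′ (subst IsSign (trans (e₁₁-steps-2ₚs-∷ʳ b 0) (corner-at-zero b)) sign)
        twos-b-inextendable {suc j} j<l₀ (extendable sign) =
          ℕ.<⇒≱ j<l₀ (proj₂ minimal-l₀ {suc j} (s≤s z≤n , extendable b∷2s-sign))
          where
          b∷2s-sign : IsSign (e₁₁ (steps (b ∷ replicate (suc j) 2ₚ)))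
          b∷2s-sign = subst IsSign (trans (e₁₁-steps-2ₚs-∷ʳ b (suc j)) (sym (e₁₁-steps-∷-2ₚs b (suc j)))) sign

        irreducible-l₀ : Irreducible (towedSolution b l₀)
        irreducible-l₀ = subst Irreducible (sym towedSolution-l₀)
          (irreducible-by-windows twos-inextendable twos-b-inextendable
            (subst IsSolution (trans (sym (towedSolution-≡ b l₀)) towedSolution-l₀)
              (extendable⇒solution (proj₂ (proj₁ minimal-l₀)))))

    module _ {b l} (minimal : IsMinimalTowLength b l) where

      l≡l₀ : (τ : TowResidue b) → l ≡ TowResidue.l₀ τ
      l≡l₀ τ = minimalTowLength-unique {b} {l} {TowResidue.l₀ τ} minimal (minimal-l₀ τ)

      explicit-form : b ≢ -ₚ 1ₚ → ∀ w → w *ₚ (b -ₚ 1ₚ) ≡ 1ₚ →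
        Σ ℕ λ l′ → 1 ≤ l′ × cls l′ ≡ (-ₚ (b +ₚ 1ₚ)) *ₚ w
                 × (∀ l″ → 1 ≤ l″ → cls l″ ≡ (-ₚ (b +ₚ 1ₚ)) *ₚ w → l′ ≤ l″)
                 × towedSolution b l ≡ (-ₚ cls (l′ + 1)) ∷ b ∷ (replicate l′ 2ₚ ++ [ b ])
      explicit-form b≢-1 w w-inverse =
        TowResidue.l₀ τ , 1≤l₀ τ , cls-toℕ (TowResidue.t τ) , (λ _ _ → cls≡⇒≤) ,
        trans (cong (towedSolution b) (l≡l₀ τ)) (towedSolution-l₀ τ)
        where
        τ = towResidue {b} {w} w-inverse b≢-1

      irreducible : b ≢ -ₚ 1ₚ × b ≢ 1ₚ × b ≢ 3ₚ → Irreducible (towedSolution b l)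
      irreducible (b≢-1 , b≢1 , b≢3) =
        subst (λ l → Irreducible (towedSolution b l)) (sym (l≡l₀ τ)) (irreducible-l₀ τ b≢-1 b≢1 b≢3)
        where
        b-1-inverse = inverse p-prime (b-1≢0 b≢1)
        τ = towResidue {b} {proj₁ b-1-inverse} (proj₂ b-1-inverse) b≢-1

      reducible-at-sign : IsSign b → Reducible (towedSolution b l)
      reducible-at-sign sign = subst Reducible (sym (towedSolution-≡ b l))
        (reducible-if-second-sign {closeˡ (b ∷ replicate l 2ₚ)} {b} {l} {closeʳ (b ∷ replicate l 2ₚ)}
          sign (proj₁ (proj₁ minimal)))

      -- For b = 3 the tow residue is t = -2, so the first entry -(t+1) of the solution is 1.
      reducible-at-three : b ≡ 3ₚ → Reducible (towedSolution b l)
      reducible-at-three b≡3ₚ = subst Reducible (sym T≡) (reducible-if-first-sign (inj₁ first≡1) (1≤l₀ τ))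
        where
        b≡3# : b ≡ 3#
        b≡3# = trans b≡3ₚ (cls≡fromℕ 3)
        b-1-inverse : ∃ λ w → w *ₚ (b -ₚ 1ₚ) ≡ 1ₚ
        b-1-inverse = inverse p-prime (λ b-1≡0 → 2#≢0 (trans (sym (trans (cong (_-ₚ 1ₚ) b≡3#) 3-1≡2)) b-1≡0))
        w = proj₁ b-1-inverse
        t≡-2 : -ₚ (b +ₚ 1ₚ) *ₚ w ≡ -ₚ 2#
        t≡-2 = trans (cong (λ c → -ₚ (c +ₚ 1ₚ) *ₚ w) b≡3#)
                     (t-at-three {w} (subst (λ c → w *ₚ (c -ₚ 1ₚ) ≡ 1ₚ) b≡3# (proj₂ b-1-inverse)))
        τ : TowResidue b
        τ = record { w = w ; w-inverse = proj₂ b-1-inverse ; t≢0 = λ t≡0 → -2#≢0 (trans (sym t≡-2) t≡0) }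
        l₀ = TowResidue.l₀ τ
        T≡ : towedSolution b l ≡ (-ₚ cls (l₀ + 1)) ∷ b ∷ (replicate l₀ 2ₚ ++ [ b ])
        T≡ = trans (cong (towedSolution b) (l≡l₀ τ)) (towedSolution-l₀ τ)
        first≡1 : -ₚ cls (l₀ + 1) ≡ 1ₚ
        first≡1 = begin
          -ₚ cls (l₀ + 1)          ≡⟨ cong -ₚ_ (cls-+ l₀ 1) ⟩
          -ₚ (cls l₀ +ₚ 1ₚ)        ≡⟨ cong (λ c → -ₚ (c +ₚ 1ₚ)) (trans (cls-toℕ _) t≡-2) ⟩
          -ₚ (-ₚ 2# +ₚ 1ₚ)         ≡⟨ -[-2+1]≡1 ⟩
          1ₚ                       ∎

proposition7p5 : (p : ℕ) {{_ : NonZero p}} → Prime p → 3 ≤ p →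
    let open ZMod p in
    (b : Zp) →
    Σ (List Zp) (λ T →
      TowedMinimal b T
      × (∀ T' → TowedMinimal b T' → T' ≡ T)
      × (Irreducible T ⇔ (b ≢ -ₚ 1ₚ × b ≢ 1ₚ × b ≢ 3ₚ))
      × ((b ≢ -ₚ 1ₚ × b ≢ 1ₚ × b ≢ 3ₚ) →
          ∀ (w : Zp) → w *ₚ (b -ₚ 1ₚ) ≡ 1ₚ →
          Σ ℕ (λ l → 1 ≤ l
            × cls l ≡ (-ₚ (b +ₚ 1ₚ)) *ₚ w
            × (∀ l' → 1 ≤ l' → cls l' ≡ (-ₚ (b +ₚ 1ₚ)) *ₚ w → l ≤ l')
            × T ≡ (-ₚ cls (l + 1)) ∷ b ∷ (replicate l 2ₚ ++ [ b ]))))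
proposition7p5 p p-prime 3≤p b =
  towedSolution b l , towedMinimal {b} {l} minimal , (λ T′ → towedMinimal-unique {b} {l} {T′} minimal) ,
  mk⇔ (λ irreducible′ → (λ b≡-1 → irreducible′ (reducible-at-sign minimal (inj₂ b≡-1)))
                       , (λ b≡1 → irreducible′ (reducible-at-sign minimal (inj₁ b≡1)))
                       , (λ b≡3 → irreducible′ (reducible-at-three minimal b≡3)))
      (irreducible minimal) ,
  λ (b≢-1 , _) → explicit-form minimal b≢-1
  where
  open Residues p
  open PrimeModulus p-prime 3≤p
  l = proj₁ (minimalTowLength 1<p b)
  minimal = proj₂ (minimalTowLength 1<p b)
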